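{- The reduced suspension functor $\Sigma_r : \mathrm{Syn}(\mathsf{MCaTT}) \to \mathrm{Syn}(\mathsf{CaTT})$ is left adjoint to the desuspension functor $\mathrm{D} : \mathrm{Syn}(\mathsf{CaTT}) \to \mathrm{Syn}(\mathsf{MCaTT})$. The counit is given by the family of substitutions $\bullet_\Gamma : \Sigma_r(\mathrm{D}\Gamma) \to \Gamma$, and the unit is a natural family of isomorphisms $\eta_\Gamma : \Gamma \to \mathrm{D}(\Sigma_r \Gamma)$. The adjunction is therefore coreflective.
   Context: $\mathsf{CaTT}$ is the Finster–Mimram dependent type theory for weak $\omega$-categories: types are $\star$ or $\mathrm{Hom}_A\,t\,u$, terms are variables or $\mathsf{op}_{\Gamma,A}[\gamma]$, $\mathsf{coh}_{\Gamma,A}[\gamma]$ indexed by ps-contexts $\Gamma$. $\mathsf{MCaTT}$ is the type theory whose types are a unit type $\mathbb{1}$ (with constant $()$ and an $\eta$-rule making every term of type $\mathbb{1}$ definitionally equal to $()$) or $\mathrm{Hom}_A\,t\,u$ (with $\star$ abbreviating $\mathrm{Hom}_{\mathbb{1}}\,()\,()$), and whose terms are variables, $()$, or $\mathsf{mop}_{\Gamma,A}[\gamma]$, $\mathsf{mcoh}_{\Gamma,A}[\gamma]$ for $\Gamma$ a $\mathsf{CaTT}$ ps-context, $A$ a valid operation (resp. coherence) type in $\mathsf{CaTT}$ and $\Delta\vdash\gamma:\mathrm{D}\Gamma$, of type $(\mathrm{D}A)[\gamma]$. $\mathrm{Syn}(T)$ is the syntactic category (contexts and substitutions, up to definitional equality).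 The desuspension $\mathrm{D}$ is defined by $\mathrm{D}\star=\mathbb{1}$, $\mathrm{D}(\mathrm{Hom}_A tu)=\mathrm{Hom}_{\mathrm{D}A}(\mathrm{D}t)(\mathrm{D}u)$, $\mathrm{D}x=x$, $\mathrm{D}(\mathsf{op}_{\Gamma,A}[\gamma])=\mathsf{mop}_{\Gamma,A}[\mathrm{D}\gamma]$, $\mathrm{D}(\mathsf{coh}_{\Gamma,A}[\gamma])=\mathsf{mcoh}_{\Gamma,A}[\mathrm{D}\gamma]$, componentwise on contexts and substitutions. The reduced suspension $\Sigma_r$ is defined on derivable $\mathsf{MCaTT}$ expressions in normal form using a fresh variable $\bullet$: $\Sigma_r\emptyset=(\bullet:\star)$, $\Sigma_r(\Gamma,x:\mathbb{1})=\Sigma_r\Gamma$, $\Sigma_r(\Gamma,x:A)=(\Sigma_r\Gamma,x:\Sigma_rA)$ for $A\neq\mathbb{1}$; $\Sigma_r\mathbb{1}=\star$, $\Sigma_r\star=\mathrm{Hom}_\star\bullet\bullet$, $\Sigma_r(\mathrm{Hom}_Atu)=\mathrm{Hom}_{\Sigma_rA}(\Sigma_rt)(\Sigma_ru)$; $\Sigma_r()=\bullet$, $\Sigma_rx=x$ for variables of type $\neq\mathbb{1}$, $\Sigma_r(\mathsf{mop}_{\Theta,A}[\gamma])=\mathsf{op}_{\Theta,A}[\bullet_\Theta\circ\Sigma_r\gamma]$ (similarly $\mathsf{mcoh}\mapsto\mathsf{coh}$); $\Sigma_r\langle\rangle=\langle\bullet\mapsto\bullet\rangle$, $\Sigma_r\langle\gamma,x\mapsto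 t\rangle=\Sigma_r\gamma$ if $x$ has type $\mathbb{1}$ and $\langle\Sigma_r\gamma,x\mapsto\Sigma_rt\rangle$ otherwise. For a $\mathsf{CaTT}$ context $\Theta$, the substitution $\bullet_\Theta$ is defined by $\bullet_\emptyset=\langle\rangle$ and $\bullet_{(\Theta,x:A)}=\langle\bullet_\Theta, x\mapsto\Sigma_r(\mathrm{D}x)\rangle$; it is a substitution $\Sigma_r(\mathrm{D}\Theta)\vdash\bullet_\Theta:\Theta$. -}

module Defs where

-- Variables are de Bruijn LEVELS (position from the start of the context),
-- so context extension never requires weakening.

open import Data.Nat using (ℕ; zero; suc; _∸_; _⊔_; _≡ᵇ_; _≤ᵇ_; _<ᵇ_; _≤_)
open import Data.Bool using (Bool; true; false; if_then_else_)
open import Data.List using (List; []; _∷_; _++_; upTo)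
open import Data.List.Membership.Propositional using (_∈_)
open import Data.Product using (Σ; _×_; _,_; proj₁; proj₂; Σ-syntax)
open import Relation.Binary.PropositionalEquality using (_≡_)

-- Finite sets of variables as lists, compared extensionally

_≐_ : List ℕ → List ℕ → Set
xs ≐ ys = ∀ x → (x ∈ xs → x ∈ ys) × (x ∈ ys → x ∈ xs)

initL : List ℕ → List ℕ
initL [] = []
initL (x ∷ []) = []
initL (x ∷ y ∷ xs) = x ∷ initL (y ∷ xs)

module C where

  data Ctx : Set
  data Ty : Set
  data Tm : Set
  data Sub : Set

  infixl 5 _▸_ _,,_

  data Ctx where
    ∅   : Ctx
    _▸_ : Ctx → Ty → Ctx

  data Ty where
    ⋆   : Ty
    Hom : Ty → Tm → Tm → Ty

  data Tm where
    var    : ℕ → Tm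
    op coh : Ctx → Ty → Sub → Tm

  data Sub where
    ⟨⟩   : Sub
    _,,_ : Sub → Tm → Sub

  len : Ctx → ℕ
  len ∅ = 0
  len (Γ ▸ _) = suc (len Γ)

  lenS : Sub → ℕ
  lenS ⟨⟩ = 0
  lenS (γ ,, _) = suc (lenS γ)

  lookupS : Sub → ℕ → Tm
  lookupS ⟨⟩ i = var i
  lookupS (γ ,, t) i = if i ≡ᵇ lenS γ then t else lookupS γ i

  _[_]T : Ty → Sub → Ty
  _[_]t : Tm → Sub → Tm
  -- γ ∘ₛ σ  is  γ[σ]  (first σ, then γ)
  _∘ₛ_ : Sub → Sub → Sub

  ⋆ [ σ ]T = ⋆
  Hom A t u [ σ ]T = Hom (A [ σ ]T) (t [ σ ]t) (u [ σ ]t)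
  var i [ σ ]t = lookupS σ i
  op Θ A γ [ σ ]t = op Θ A (γ ∘ₛ σ)
  coh Θ A γ [ σ ]t = coh Θ A (γ ∘ₛ σ)
  ⟨⟩ ∘ₛ σ = ⟨⟩
  (γ ,, t) ∘ₛ σ = (γ ∘ₛ σ) ,, (t [ σ ]t)

  idS : Ctx → Sub
  idS ∅ = ⟨⟩
  idS (Γ ▸ _) = idS Γ ,, var (len Γ)

  fvT : Ty → List ℕ
  fvt : Tm → List ℕ
  fvS : Sub → List ℕ
  fvT ⋆ = []
  fvT (Hom A t u) = fvT A ++ (fvt t ++ fvt u)
  fvt (var i) = i ∷ []
  fvt (op _ _ γ) = fvS γ
  fvt (coh _ _ γ) = fvS γ
  fvS ⟨⟩ = []
  fvS (γ ,, t) = fvS γ ++ fvt t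

  dimT : Ty → ℕ
  dimT ⋆ = 0
  dimT (Hom A _ _) = suc (dimT A)

  dimC : Ctx → ℕ
  dimC ∅ = 0
  dimC (Γ ▸ A) = dimC Γ ⊔ dimT A

  -- variables of the i-source / i-target of a ps-context
  -- (Finster–Mimram: a ps-context is (x:⋆) or (Γ, y:A, f:Hom_A x y))
  ∂⁻ᵢ : ℕ → Ctx → List ℕ
  ∂⁻ᵢ i ∅ = []
  ∂⁻ᵢ i (∅ ▸ _) = 0 ∷ []
  ∂⁻ᵢ i (Γ ▸ A ▸ _) =
    if i ≤ᵇ dimT A then ∂⁻ᵢ i Γ else ∂⁻ᵢ i Γ ++ (len Γ ∷ suc (len Γ) ∷ [])

  ∂⁺ᵢ : ℕ → Ctx → List ℕ
  ∂⁺ᵢ i ∅ = []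
  ∂⁺ᵢ i (∅ ▸ _) = 0 ∷ []
  ∂⁺ᵢ i (Γ ▸ A ▸ _) =
    if i <ᵇ dimT A then ∂⁺ᵢ i Γ
    else (if dimT A ≡ᵇ i then initL (∂⁺ᵢ i Γ) ++ (len Γ ∷ [])
          else ∂⁺ᵢ i Γ ++ (len Γ ∷ suc (len Γ) ∷ []))

  ∂⁻ ∂⁺ : Ctx → List ℕ
  ∂⁻ Γ = ∂⁻ᵢ (dimC Γ ∸ 1) Γ
  ∂⁺ Γ = ∂⁺ᵢ (dimC Γ ∸ 1) Γ

  data _∋_∶_ : Ctx → ℕ → Ty → Set where
    here  : ∀ {Γ A} → (Γ ▸ A) ∋ len Γ ∶ A
    there : ∀ {Γ A B i} → Γ ∋ i ∶ A → (Γ ▸ B) ∋ i ∶ A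

  data PsTm : Ctx → Tm → Ty → Set where
    ps-start : PsTm (∅ ▸ ⋆) (var 0) ⋆
    ps-ext   : ∀ {Γ x A} → PsTm Γ x A →
               PsTm (Γ ▸ A ▸ Hom A x (var (len Γ)))
                    (var (suc (len Γ))) (Hom A x (var (len Γ)))
    ps-drop  : ∀ {Γ f A x y} → PsTm Γ f (Hom A x y) → PsTm Γ y A

  data IsPs : Ctx → Set where
    ps : ∀ {Γ x} → PsTm Γ x ⋆ → IsPs Γ

  data _⊢ : Ctx → Set
  data _⊢T_ : Ctx → Ty → Set
  data _⊢_∶_ : Ctx → Tm → Ty → Set
  data _⊢ₛ_∶_ : Ctx → Sub → Ctx → Set
  data IsOpTy : Ctx → Ty → Set
  data IsCohTy : Ctx → Ty → Set

  data _⊢ where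
    ∅⊢ : ∅ ⊢
    ▸⊢ : ∀ {Γ A} → Γ ⊢T A → (Γ ▸ A) ⊢

  data _⊢T_ where
    ⋆⊢   : ∀ {Γ} → Γ ⊢ → Γ ⊢T ⋆
    Hom⊢ : ∀ {Γ A t u} → Γ ⊢T A → Γ ⊢ t ∶ A → Γ ⊢ u ∶ A → Γ ⊢T Hom A t u

  data _⊢_∶_ where
    var⊢ : ∀ {Γ i A} → Γ ⊢ → Γ ∋ i ∶ A → Γ ⊢ var i ∶ A
    op⊢  : ∀ {Δ Θ A γ} → IsOpTy Θ A → Δ ⊢ₛ γ ∶ Θ → Δ ⊢ op Θ A γ ∶ (A [ γ ]T)
    coh⊢ : ∀ {Δ Θ A γ} → IsCohTy Θ A → Δ ⊢ₛ γ ∶ Θ → Δ ⊢ coh Θ A γ ∶ (A [ γ ]T)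

  data _⊢ₛ_∶_ where
    ⟨⟩⊢ : ∀ {Δ} → Δ ⊢ → Δ ⊢ₛ ⟨⟩ ∶ ∅
    ,,⊢ : ∀ {Δ Γ γ A t} → Δ ⊢ₛ γ ∶ Γ → Γ ⊢T A → Δ ⊢ t ∶ (A [ γ ]T) →
          Δ ⊢ₛ (γ ,, t) ∶ (Γ ▸ A)

  data IsOpTy where
    isOp : ∀ {Θ A t u} → IsPs Θ → 1 ≤ dimC Θ → Θ ⊢T Hom A t u →
           (fvT A ++ fvt t) ≐ ∂⁻ Θ → (fvT A ++ fvt u) ≐ ∂⁺ Θ →
           IsOpTy Θ (Hom A t u)

  data IsCohTy where
    isCoh : ∀ {Θ A t u} → IsPs Θ → Θ ⊢T Hom A t u →
            (fvT A ++ fvt t) ≐ upTo (len Θ) → (fvT A ++ fvt u) ≐ upTo (len Θ) →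
            IsCohTy Θ (Hom A t u)

module M where

  data Ctx : Set
  data Ty : Set
  data Tm : Set
  data Sub : Set

  infixl 5 _▸_ _,,_

  data Ctx where
    ∅   : Ctx
    _▸_ : Ctx → Ty → Ctx

  data Ty where
    𝟙   : Ty
    Hom : Ty → Tm → Tm → Ty

  data Tm where
    var      : ℕ → Tm
    tt       : Tm
    mop mcoh : C.Ctx → C.Ty → Sub → Tm

  data Sub where
    ⟨⟩   : Sub
    _,,_ : Sub → Tm → Sub

  ⋆ : Ty
  ⋆ = Hom 𝟙 tt tt

  len : Ctx → ℕ
  len ∅ = 0
  len (Γ ▸ _) = suc (len Γ)

  lenS : Sub → ℕ
  lenS ⟨⟩ = 0
  lenS (γ ,, _) = suc (lenS γ)

  lookupS : Sub → ℕ → Tm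
  lookupS ⟨⟩ i = var i
  lookupS (γ ,, t) i = if i ≡ᵇ lenS γ then t else lookupS γ i

  _[_]T : Ty → Sub → Ty
  _[_]t : Tm → Sub → Tm
  _∘ₛ_ : Sub → Sub → Sub

  𝟙 [ σ ]T = 𝟙
  Hom A t u [ σ ]T = Hom (A [ σ ]T) (t [ σ ]t) (u [ σ ]t)
  var i [ σ ]t = lookupS σ i
  tt [ σ ]t = tt
  mop Θ A γ [ σ ]t = mop Θ A (γ ∘ₛ σ)
  mcoh Θ A γ [ σ ]t = mcoh Θ A (γ ∘ₛ σ)
  ⟨⟩ ∘ₛ σ = ⟨⟩
  (γ ,, t) ∘ₛ σ = (γ ∘ₛ σ) ,, (t [ σ ]t)

  idS : Ctx → Sub
  idS ∅ = ⟨⟩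
  idS (Γ ▸ _) = idS Γ ,, var (len Γ)

  data _∋_∶_ : Ctx → ℕ → Ty → Set where
    here  : ∀ {Γ A} → (Γ ▸ A) ∋ len Γ ∶ A
    there : ∀ {Γ A B i} → Γ ∋ i ∶ A → (Γ ▸ B) ∋ i ∶ A

DT : C.Ty → M.Ty
Dt : C.Tm → M.Tm
DS : C.Sub → M.Sub
DT C.⋆ = M.𝟙
DT (C.Hom A t u) = M.Hom (DT A) (Dt t) (Dt u)
Dt (C.var i) = M.var i
Dt (C.op Θ A γ) = M.mop Θ A (DS γ)
Dt (C.coh Θ A γ) = M.mcoh Θ A (DS γ)
DS C.⟨⟩ = M.⟨⟩
DS (γ C.,, t) = DS γ M.,, Dt t

DC : C.Ctx → M.Ctx
DC C.∅ = M.∅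
DC (Γ C.▸ A) = DC Γ M.▸ DT A

module MT where
  open M

  data _⊢ : Ctx → Set
  data _⊢T_ : Ctx → Ty → Set
  data _⊢_∶_ : Ctx → Tm → Ty → Set
  data _⊢ₛ_∶_ : Ctx → Sub → Ctx → Set
  data _⊢_≣T_ : Ctx → Ty → Ty → Set
  data _⊢_≣_∶_ : Ctx → Tm → Tm → Ty → Set
  data _⊢ₛ_≣_∶_ : Ctx → Sub → Sub → Ctx → Set

  data _⊢ where
    ∅⊢ : ∅ ⊢
    ▸⊢ : ∀ {Γ A} → Γ ⊢T A → (Γ ▸ A) ⊢

  data _⊢T_ where
    𝟙⊢   : ∀ {Γ} → Γ ⊢ → Γ ⊢T 𝟙
    Hom⊢ : ∀ {Γ A t u} → Γ ⊢T A → Γ ⊢ t ∶ A → Γ ⊢ u ∶ A → Γ ⊢T Hom A t u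

  data _⊢_∶_ where
    var⊢  : ∀ {Γ i A} → Γ ⊢ → Γ ∋ i ∶ A → Γ ⊢ var i ∶ A
    tt⊢   : ∀ {Γ} → Γ ⊢ → Γ ⊢ tt ∶ 𝟙
    mop⊢  : ∀ {Δ Θ A γ} → C.IsOpTy Θ A → Δ ⊢ₛ γ ∶ DC Θ →
            Δ ⊢ mop Θ A γ ∶ (DT A [ γ ]T)
    mcoh⊢ : ∀ {Δ Θ A γ} → C.IsCohTy Θ A → Δ ⊢ₛ γ ∶ DC Θ →
            Δ ⊢ mcoh Θ A γ ∶ (DT A [ γ ]T)
    conv⊢ : ∀ {Γ t A B} → Γ ⊢ t ∶ A → Γ ⊢ A ≣T B → Γ ⊢ t ∶ B

  data _⊢ₛ_∶_ where
    ⟨⟩⊢ : ∀ {Δ} → Δ ⊢ → Δ ⊢ₛ ⟨⟩ ∶ ∅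
    ,,⊢ : ∀ {Δ Γ γ A t} → Δ ⊢ₛ γ ∶ Γ → Γ ⊢T A → Δ ⊢ t ∶ (A [ γ ]T) →
          Δ ⊢ₛ (γ ,, t) ∶ (Γ ▸ A)

  data _⊢_≣T_ where
    𝟙≣    : ∀ {Γ} → Γ ⊢ → Γ ⊢ 𝟙 ≣T 𝟙
    Hom≣  : ∀ {Γ A A' t t' u u'} → Γ ⊢ A ≣T A' → Γ ⊢ t ≣ t' ∶ A → Γ ⊢ u ≣ u' ∶ A →
            Γ ⊢ Hom A t u ≣T Hom A' t' u'
    symT  : ∀ {Γ A B} → Γ ⊢ A ≣T B → Γ ⊢ B ≣T A
    transT : ∀ {Γ A B D} → Γ ⊢ A ≣T B → Γ ⊢ B ≣T D → Γ ⊢ A ≣T D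

  data _⊢_≣_∶_ where
    refl≣  : ∀ {Γ t A} → Γ ⊢ t ∶ A → Γ ⊢ t ≣ t ∶ A
    sym≣   : ∀ {Γ t u A} → Γ ⊢ t ≣ u ∶ A → Γ ⊢ u ≣ t ∶ A
    trans≣ : ∀ {Γ t u v A} → Γ ⊢ t ≣ u ∶ A → Γ ⊢ u ≣ v ∶ A → Γ ⊢ t ≣ v ∶ A
    conv≣  : ∀ {Γ t u A B} → Γ ⊢ t ≣ u ∶ A → Γ ⊢ A ≣T B → Γ ⊢ t ≣ u ∶ B
    η𝟙     : ∀ {Γ t} → Γ ⊢ t ∶ 𝟙 → Γ ⊢ t ≣ tt ∶ 𝟙
    mop≣   : ∀ {Δ Θ A γ δ} → C.IsOpTy Θ A → Δ ⊢ₛ γ ≣ δ ∶ DC Θ →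
             Δ ⊢ mop Θ A γ ≣ mop Θ A δ ∶ (DT A [ γ ]T)
    mcoh≣  : ∀ {Δ Θ A γ δ} → C.IsCohTy Θ A → Δ ⊢ₛ γ ≣ δ ∶ DC Θ →
             Δ ⊢ mcoh Θ A γ ≣ mcoh Θ A δ ∶ (DT A [ γ ]T)

  data _⊢ₛ_≣_∶_ where
    ⟨⟩≣ : ∀ {Δ} → Δ ⊢ → Δ ⊢ₛ ⟨⟩ ≣ ⟨⟩ ∶ ∅
    ,,≣ : ∀ {Δ Γ γ δ A t u} → Δ ⊢ₛ γ ≣ δ ∶ Γ → Γ ⊢T A → Δ ⊢ t ≣ u ∶ (A [ γ ]T) →
          Δ ⊢ₛ (γ ,, t) ≣ (δ ,, u) ∶ (Γ ▸ A)

-- Reduced suspension Σ_r : MCaTT → CaTT   (• is the variable of level 0)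
-- Variables of type 𝟙 are sent to • (this is Σ_r on the normal form,
-- where such variables are replaced by ()).

isUnit : M.Ty → Bool
isUnit M.𝟙 = true
isUnit (M.Hom _ _ _) = false

nu : M.Ctx → ℕ
nu M.∅ = 0
nu (Γ M.▸ A) = if isUnit A then nu Γ else suc (nu Γ)

Σv : M.Ctx → ℕ → C.Tm
Σv M.∅ i = C.var 0
Σv (Γ M.▸ A) i =
  if i ≡ᵇ M.len Γ then (if isUnit A then C.var 0 else C.var (suc (nu Γ)))
  else Σv Γ i

bullet : C.Ctx → C.Sub
bullet C.∅ = C.⟨⟩
bullet (Θ C.▸ A) = bullet Θ C.,, Σv (DC (Θ C.▸ A)) (C.len Θ)

ΣrC : M.Ctx → C.Ctx
ΣrT : M.Ctx → M.Ty → C.Ty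
Σrt : M.Ctx → M.Tm → C.Tm
-- ΣrS Δ Γ γ : the suspension of  Δ ⊢ γ : Γ
ΣrS : M.Ctx → M.Ctx → M.Sub → C.Sub

ΣrC M.∅ = C.∅ C.▸ C.⋆
ΣrC (Γ M.▸ A) = if isUnit A then ΣrC Γ else (ΣrC Γ C.▸ ΣrT Γ A)

ΣrT Γ M.𝟙 = C.⋆
ΣrT Γ (M.Hom A t u) = C.Hom (ΣrT Γ A) (Σrt Γ t) (Σrt Γ u)

Σrt Γ (M.var i) = Σv Γ i
Σrt Γ M.tt = C.var 0
Σrt Γ (M.mop Θ A γ) = C.op Θ A (bullet Θ C.∘ₛ ΣrS Γ (DC Θ) γ)
Σrt Γ (M.mcoh Θ A γ) = C.coh Θ A (bullet Θ C.∘ₛ ΣrS Γ (DC Θ) γ)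

ΣrS Δ M.∅ γ = C.⟨⟩ C.,, C.var 0
ΣrS Δ (Γ M.▸ A) M.⟨⟩ = C.⟨⟩
ΣrS Δ (Γ M.▸ A) (γ M.,, t) =
  if isUnit A then ΣrS Δ Γ γ else (ΣrS Δ Γ γ C.,, Σrt Δ t)

record Category : Set₁ where
  infix 4 _≈_
  infixr 9 _∘_
  field
    Obj : Set
    _⇒_ : Obj → Obj → Set
    _≈_ : ∀ {A B} → A ⇒ B → A ⇒ B → Set
    id  : ∀ {A} → A ⇒ A
    _∘_ : ∀ {A B D} → B ⇒ D → A ⇒ B → A ⇒ D
    ≈-refl  : ∀ {A B} {f : A ⇒ B} → f ≈ f
    ≈-sym   : ∀ {A B} {f g : A ⇒ B} → f ≈ g → g ≈ f
    ≈-trans : ∀ {A B} {f g h : A ⇒ B} → f ≈ g → g ≈ h → f ≈ h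
    ∘-resp-≈ : ∀ {A B D} {f h : B ⇒ D} {g i : A ⇒ B} → f ≈ h → g ≈ i → f ∘ g ≈ h ∘ i
    assoc : ∀ {A B D E} {f : A ⇒ B} {g : B ⇒ D} {h : D ⇒ E} → (h ∘ g) ∘ f ≈ h ∘ (g ∘ f)
    identityˡ : ∀ {A B} {f : A ⇒ B} → id ∘ f ≈ f
    identityʳ : ∀ {A B} {f : A ⇒ B} → f ∘ id ≈ f

record Functor (𝒞 𝒟 : Category) : Set where
  private
    module 𝒞 = Category 𝒞
    module 𝒟 = Category 𝒟
  field
    F₀ : 𝒞.Obj → 𝒟.Obj
    F₁ : ∀ {A B} → A 𝒞.⇒ B → F₀ A 𝒟.⇒ F₀ B
    identity : ∀ {A} → F₁ (𝒞.id {A}) 𝒟.≈ 𝒟.id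
    homomorphism : ∀ {A B D} {f : A 𝒞.⇒ B} {g : B 𝒞.⇒ D} →
                   F₁ (g 𝒞.∘ f) 𝒟.≈ F₁ g 𝒟.∘ F₁ f
    F-resp-≈ : ∀ {A B} {f g : A 𝒞.⇒ B} → f 𝒞.≈ g → F₁ f 𝒟.≈ F₁ g

record Adjunction {𝒞 𝒟 : Category} (L : Functor 𝒞 𝒟) (R : Functor 𝒟 𝒞) : Set where
  private
    module 𝒞 = Category 𝒞
    module 𝒟 = Category 𝒟
    module L = Functor L
    module R = Functor R
  field
    unit   : ∀ X → X 𝒞.⇒ R.F₀ (L.F₀ X)
    counit : ∀ Y → L.F₀ (R.F₀ Y) 𝒟.⇒ Y
    unit-natural : ∀ {X X'} (f : X 𝒞.⇒ X') →
                   R.F₁ (L.F₁ f) 𝒞.∘ unit X 𝒞.≈ unit X' 𝒞.∘ f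
    counit-natural : ∀ {Y Y'} (g : Y 𝒟.⇒ Y') →
                     counit Y' 𝒟.∘ L.F₁ (R.F₁ g) 𝒟.≈ g 𝒟.∘ counit Y
    zig : ∀ X → counit (L.F₀ X) 𝒟.∘ L.F₁ (unit X) 𝒟.≈ 𝒟.id
    zag : ∀ Y → R.F₁ (counit Y) 𝒞.∘ unit (R.F₀ Y) 𝒞.≈ 𝒞.id

IsIso : (𝒞 : Category) → ∀ {A B} → Category._⇒_ 𝒞 A B → Set
IsIso 𝒞 {A} {B} f =
  Σ[ g ∈ B ⇒ A ] ((g ∘ f ≈ id) × (f ∘ g ≈ id))
  where open Category 𝒞

record SynData : Set₁ where
  field
    Ctx Sub : Set
    WfCtx : Ctx → Set
    WfSub : Ctx → Sub → Ctx → Set          -- Δ ⊢ γ : Γ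
    EqSub : Ctx → Sub → Sub → Ctx → Set    -- Δ ⊢ γ ≡ δ : Γ
    idS   : Ctx → Sub
    _∘S_  : Sub → Sub → Sub                -- γ ∘S δ = γ[δ]

record IsSynCat (S : SynData) : Set where
  open SynData S
  field
    id-wf : ∀ {Γ} → WfCtx Γ → WfSub Γ (idS Γ) Γ
    ∘-wf  : ∀ {Θ Δ Γ γ δ} → WfSub Δ γ Γ → WfSub Θ δ Δ → WfSub Θ (γ ∘S δ) Γ
    ≈-refl  : ∀ {Δ Γ γ} → WfSub Δ γ Γ → EqSub Δ γ γ Γ
    ≈-sym   : ∀ {Δ Γ γ δ} → WfSub Δ γ Γ → WfSub Δ δ Γ → EqSub Δ γ δ Γ → EqSub Δ δ γ Γ
    ≈-trans : ∀ {Δ Γ γ δ σ} → WfSub Δ γ Γ → WfSub Δ δ Γ → WfSub Δ σ Γ →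
              EqSub Δ γ δ Γ → EqSub Δ δ σ Γ → EqSub Δ γ σ Γ
    ∘-resp  : ∀ {Θ Δ Γ γ γ' δ δ'} → WfSub Δ γ Γ → WfSub Δ γ' Γ →
              WfSub Θ δ Δ → WfSub Θ δ' Δ →
              EqSub Δ γ γ' Γ → EqSub Θ δ δ' Δ → EqSub Θ (γ ∘S δ) (γ' ∘S δ') Γ
    assoc   : ∀ {Ξ Θ Δ Γ γ δ σ} → WfSub Δ γ Γ → WfSub Θ δ Δ → WfSub Ξ σ Θ →
              EqSub Ξ ((γ ∘S δ) ∘S σ) (γ ∘S (δ ∘S σ)) Γ
    idˡ     : ∀ {Δ Γ γ} → WfCtx Δ → WfCtx Γ → WfSub Δ γ Γ → EqSub Δ (idS Γ ∘S γ) γ Γ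
    idʳ     : ∀ {Δ Γ γ} → WfCtx Δ → WfCtx Γ → WfSub Δ γ Γ → EqSub Δ (γ ∘S idS Δ) γ Γ

Syn : (S : SynData) → IsSynCat S → Category
Syn S L = record
  { Obj = Σ Ctx WfCtx
  ; _⇒_ = λ X Y → Σ Sub (λ γ → WfSub (proj₁ X) γ (proj₁ Y))
  ; _≈_ = λ {X} {Y} f g → EqSub (proj₁ X) (proj₁ f) (proj₁ g) (proj₁ Y)
  ; id = λ {X} → idS (proj₁ X) , id-wf (proj₂ X)
  ; _∘_ = λ f g → (proj₁ f ∘S proj₁ g) , ∘-wf (proj₂ f) (proj₂ g)
  ; ≈-refl = λ {_} {_} {f} → ≈-refl (proj₂ f)
  ; ≈-sym = λ {_} {_} {f} {g} → ≈-sym (proj₂ f) (proj₂ g)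
  ; ≈-trans = λ {_} {_} {f} {g} {h} → ≈-trans (proj₂ f) (proj₂ g) (proj₂ h)
  ; ∘-resp-≈ = λ {_} {_} {_} {f} {h} {g} {i} →
      ∘-resp (proj₂ f) (proj₂ h) (proj₂ g) (proj₂ i)
  ; assoc = λ {_} {_} {_} {_} {f} {g} {h} → assoc (proj₂ h) (proj₂ g) (proj₂ f)
  ; identityˡ = λ {X} {Y} {f} → idˡ (proj₂ X) (proj₂ Y) (proj₂ f)
  ; identityʳ = λ {X} {Y} {f} → idʳ (proj₂ X) (proj₂ Y) (proj₂ f)
  }
  where open SynData S
        open IsSynCat L

-- A functor between syntactic categories given by raw maps on contexts
-- and on substitutions (F₁ Δ Γ γ is the image of Δ ⊢ γ : Γ).
record IsSynFunctor (S S' : SynData)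
                    (F₀ : SynData.Ctx S → SynData.Ctx S')
                    (F₁ : SynData.Ctx S → SynData.Ctx S → SynData.Sub S → SynData.Sub S')
                    : Set where
  private
    module S = SynData S
    module S' = SynData S'
  field
    F₀-wf : ∀ {Γ} → S.WfCtx Γ → S'.WfCtx (F₀ Γ)
    F₁-wf : ∀ {Δ Γ γ} → S.WfCtx Δ → S.WfCtx Γ → S.WfSub Δ γ Γ →
            S'.WfSub (F₀ Δ) (F₁ Δ Γ γ) (F₀ Γ)
    F₁-resp : ∀ {Δ Γ γ δ} → S.WfCtx Δ → S.WfCtx Γ →
              S.WfSub Δ γ Γ → S.WfSub Δ δ Γ → S.EqSub Δ γ δ Γ →
              S'.EqSub (F₀ Δ) (F₁ Δ Γ γ) (F₁ Δ Γ δ) (F₀ Γ)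
    F-id : ∀ {Γ} → S.WfCtx Γ →
           S'.EqSub (F₀ Γ) (F₁ Γ Γ (S.idS Γ)) (S'.idS (F₀ Γ)) (F₀ Γ)
    F-∘ : ∀ {Θ Δ Γ γ δ} → S.WfCtx Θ → S.WfCtx Δ → S.WfCtx Γ →
          S.WfSub Δ γ Γ → S.WfSub Θ δ Δ →
          S'.EqSub (F₀ Θ) (F₁ Θ Γ (γ S.∘S δ)) (F₁ Δ Γ γ S'.∘S F₁ Θ Δ δ) (F₀ Γ)

SynFunctor : ∀ {S S' F₀ F₁} (L : IsSynCat S) (L' : IsSynCat S') →
             IsSynFunctor S S' F₀ F₁ → Functor (Syn S L) (Syn S' L')
SynFunctor {F₀ = F₀} {F₁ = F₁} L L' isF = record
  { F₀ = λ X → F₀ (proj₁ X) , F₀-wf (proj₂ X)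
  ; F₁ = λ {X} {Y} f → F₁ (proj₁ X) (proj₁ Y) (proj₁ f) , F₁-wf (proj₂ X) (proj₂ Y) (proj₂ f)
  ; identity = λ {X} → F-id (proj₂ X)
  ; homomorphism = λ {X} {Y} {Z} {f} {g} → F-∘ (proj₂ X) (proj₂ Y) (proj₂ Z) (proj₂ g) (proj₂ f)
  ; F-resp-≈ = λ {X} {Y} {f} {g} → F₁-resp (proj₂ X) (proj₂ Y) (proj₂ f) (proj₂ g)
  }
  where open IsSynFunctor isF

CaTT : SynData
CaTT = record
  { Ctx = C.Ctx ; Sub = C.Sub
  ; WfCtx = C._⊢
  ; WfSub = C._⊢ₛ_∶_
  ; EqSub = λ Δ γ δ Γ → γ ≡ δ       -- CaTT has only syntactic equality
  ; idS = C.idS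
  ; _∘S_ = C._∘ₛ_
  }

MCaTT : SynData
MCaTT = record
  { Ctx = M.Ctx ; Sub = M.Sub
  ; WfCtx = MT._⊢
  ; WfSub = MT._⊢ₛ_∶_
  ; EqSub = MT._⊢ₛ_≣_∶_
  ; idS = M.idS
  ; _∘S_ = M._∘ₛ_
  }

D₁ : C.Ctx → C.Ctx → C.Sub → M.Sub
D₁ _ _ γ = DS γ

-- Two computations carry the adjunction. First, Σr (D t) = t[•_Θ] for every CaTT term t in context Θ:
-- this is the naturality of the counit, and for Θ = Σr Γ the substitution •_Θ is the identity.
-- Second, every MCaTT term t in context Γ is definitionally equal to D(Σr t)[η Γ]:
-- Σr only collapses the terms of type 𝟙 to •, and the η-rule makes all of them equal to ().
-- This gives the naturality of the unit, and its inverse x ↦ D(Σr x) is checked pointwise on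
-- variables, again by the η-rule.

module Submission where

open import Defs
open import Data.Bool using (true; false; T; if_then_else_)
open import Data.Nat using (ℕ; zero; suc; _≡ᵇ_; _<_; _≤_; z≤n; s≤s)
open import Data.Nat.Properties
  using (≤-refl; ≤-trans; n≤1+n; m<n⇒m<1+n; m<1+n⇒m<n∨m≡n; suc-injective; ≡ᵇ⇒≡)
open import Data.Product using (_×_; _,_; proj₁; proj₂; Σ-syntax)
open import Data.Sum using (inj₁; inj₂)
open import Relation.Binary.PropositionalEquality
  using (_≡_; refl; sym; trans; cong; cong₂; subst; subst₂; module ≡-Reasoning)

cong₃ : ∀ {A B D E : Set} (f : A → B → D → E) {a a' b b' d d'} →
        a ≡ a' → b ≡ b' → d ≡ d' → f a b d ≡ f a' b' d'
cong₃ f refl refl refl = refl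

≡ᵇ-refl : ∀ n → (n ≡ᵇ n) ≡ true
≡ᵇ-refl zero = refl
≡ᵇ-refl (suc n) = ≡ᵇ-refl n

<⇒≡ᵇ-false : ∀ {m n} → m < n → (m ≡ᵇ n) ≡ false
<⇒≡ᵇ-false {zero} {suc n} _ = refl
<⇒≡ᵇ-false {suc m} {suc n} (s≤s m<n) = <⇒≡ᵇ-false m<n

module C-Properties where
  open C

  data ScopedTy (n : ℕ) : Ty → Set
  data ScopedTm (n : ℕ) : Tm → Set
  data ScopedSub (n : ℕ) : Sub → Set

  data ScopedTy n where
    ⋆ˢ   : ScopedTy n ⋆
    Homˢ : ∀ {A t u} → ScopedTy n A → ScopedTm n t → ScopedTm n u → ScopedTy n (Hom A t u)

  data ScopedTm n where
    varˢ : ∀ {i} → i < n → ScopedTm n (var i)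
    opˢ  : ∀ {Θ A γ} → ScopedSub n γ → ScopedTm n (op Θ A γ)
    cohˢ : ∀ {Θ A γ} → ScopedSub n γ → ScopedTm n (coh Θ A γ)

  data ScopedSub n where
    ⟨⟩ˢ  : ScopedSub n ⟨⟩
    ,,ˢ  : ∀ {γ t} → ScopedSub n γ → ScopedTm n t → ScopedSub n (γ ,, t)

  ScopedTy-mono  : ∀ {m n A} → m ≤ n → ScopedTy m A → ScopedTy n A
  ScopedTm-mono  : ∀ {m n t} → m ≤ n → ScopedTm m t → ScopedTm n t
  ScopedSub-mono : ∀ {m n γ} → m ≤ n → ScopedSub m γ → ScopedSub n γ
  ScopedTy-mono le ⋆ˢ = ⋆ˢ
  ScopedTy-mono le (Homˢ a t u) = Homˢ (ScopedTy-mono le a) (ScopedTm-mono le t) (ScopedTm-mono le u)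
  ScopedTm-mono le (varˢ i<m) = varˢ (≤-trans i<m le)
  ScopedTm-mono le (opˢ γ) = opˢ (ScopedSub-mono le γ)
  ScopedTm-mono le (cohˢ γ) = cohˢ (ScopedSub-mono le γ)
  ScopedSub-mono le ⟨⟩ˢ = ⟨⟩ˢ
  ScopedSub-mono le (,,ˢ γ t) = ,,ˢ (ScopedSub-mono le γ) (ScopedTm-mono le t)

  lenS-∘ₛ : ∀ γ δ → lenS (γ ∘ₛ δ) ≡ lenS γ
  lenS-∘ₛ ⟨⟩ δ = refl
  lenS-∘ₛ (γ ,, t) δ = cong suc (lenS-∘ₛ γ δ)

  lookupS-top : ∀ {n} γ t → lenS γ ≡ n → lookupS (γ ,, t) n ≡ t
  lookupS-top γ t refl rewrite ≡ᵇ-refl (lenS γ) = refl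

  lookupS-pop : ∀ {i} γ t → i < lenS γ → lookupS (γ ,, t) i ≡ lookupS γ i
  lookupS-pop γ t i<γ rewrite <⇒≡ᵇ-false i<γ = refl

  []T-extend : ∀ {γ u A} → ScopedTy (lenS γ) A → A [ γ ,, u ]T ≡ A [ γ ]T
  []t-extend : ∀ {γ u t} → ScopedTm (lenS γ) t → t [ γ ,, u ]t ≡ t [ γ ]t
  ∘ₛ-extend  : ∀ {γ u σ} → ScopedSub (lenS γ) σ → σ ∘ₛ (γ ,, u) ≡ σ ∘ₛ γ
  []T-extend ⋆ˢ = refl
  []T-extend (Homˢ a t u) = cong₃ Hom ([]T-extend a) ([]t-extend t) ([]t-extend u)
  []t-extend {γ} {u} (varˢ i<γ) = lookupS-pop γ u i<γ
  []t-extend (opˢ σ) = cong (op _ _) (∘ₛ-extend σ)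
  []t-extend (cohˢ σ) = cong (coh _ _) (∘ₛ-extend σ)
  ∘ₛ-extend ⟨⟩ˢ = refl
  ∘ₛ-extend (,,ˢ σ t) = cong₂ _,,_ (∘ₛ-extend σ) ([]t-extend t)

  lookupS-∘ₛ : ∀ γ δ i → i < lenS γ → lookupS (γ ∘ₛ δ) i ≡ lookupS γ i [ δ ]t
  lookupS-∘ₛ (γ ,, t) δ i i<γ with m<1+n⇒m<n∨m≡n i<γ
  ... | inj₂ refl = trans (lookupS-top (γ ∘ₛ δ) _ (lenS-∘ₛ γ δ)) (cong (_[ δ ]t) (sym (lookupS-top γ t refl)))
  ... | inj₁ i<γ' = begin
    lookupS ((γ ∘ₛ δ) ,, t [ δ ]t) i ≡⟨ lookupS-pop (γ ∘ₛ δ) _ (subst (i <_) (sym (lenS-∘ₛ γ δ)) i<γ') ⟩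
    lookupS (γ ∘ₛ δ) i               ≡⟨ lookupS-∘ₛ γ δ i i<γ' ⟩
    lookupS γ i [ δ ]t               ≡⟨ cong (_[ δ ]t) (sym (lookupS-pop γ t i<γ')) ⟩
    lookupS (γ ,, t) i [ δ ]t        ∎
    where open ≡-Reasoning

  []T-∘ₛ  : ∀ {γ δ A} → ScopedTy (lenS γ) A → A [ γ ]T [ δ ]T ≡ A [ γ ∘ₛ δ ]T
  []t-∘ₛ  : ∀ {γ δ t} → ScopedTm (lenS γ) t → t [ γ ]t [ δ ]t ≡ t [ γ ∘ₛ δ ]t
  ∘ₛ-assoc : ∀ {γ δ σ} → ScopedSub (lenS γ) σ → (σ ∘ₛ γ) ∘ₛ δ ≡ σ ∘ₛ (γ ∘ₛ δ)
  []T-∘ₛ ⋆ˢ = refl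
  []T-∘ₛ (Homˢ a t u) = cong₃ Hom ([]T-∘ₛ a) ([]t-∘ₛ t) ([]t-∘ₛ u)
  []t-∘ₛ {γ} {δ} (varˢ {i} i<γ) = sym (lookupS-∘ₛ γ δ i i<γ)
  []t-∘ₛ (opˢ σ) = cong (op _ _) (∘ₛ-assoc σ)
  []t-∘ₛ (cohˢ σ) = cong (coh _ _) (∘ₛ-assoc σ)
  ∘ₛ-assoc ⟨⟩ˢ = refl
  ∘ₛ-assoc (,,ˢ σ t) = cong₂ _,,_ (∘ₛ-assoc σ) ([]t-∘ₛ t)

  lenS-idS : ∀ Γ → lenS (idS Γ) ≡ len Γ
  lenS-idS ∅ = refl
  lenS-idS (Γ ▸ A) = cong suc (lenS-idS Γ)

  lookupS-idS : ∀ Γ i → lookupS (idS Γ) i ≡ var i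
  lookupS-idS ∅ i = refl
  lookupS-idS (Γ ▸ A) i with i ≡ᵇ lenS (idS Γ) in eq
  ... | true = cong var (sym (trans (≡ᵇ⇒≡ i _ (subst T (sym eq) _)) (lenS-idS Γ)))
  ... | false = lookupS-idS Γ i

  []T-idS : ∀ Γ A → A [ idS Γ ]T ≡ A
  []t-idS : ∀ Γ t → t [ idS Γ ]t ≡ t
  ∘ₛ-identityʳ : ∀ Γ σ → σ ∘ₛ idS Γ ≡ σ
  []T-idS Γ ⋆ = refl
  []T-idS Γ (Hom A t u) = cong₃ Hom ([]T-idS Γ A) ([]t-idS Γ t) ([]t-idS Γ u)
  []t-idS Γ (var i) = lookupS-idS Γ i
  []t-idS Γ (op Θ A γ) = cong (op Θ A) (∘ₛ-identityʳ Γ γ)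
  []t-idS Γ (coh Θ A γ) = cong (coh Θ A) (∘ₛ-identityʳ Γ γ)
  ∘ₛ-identityʳ Γ ⟨⟩ = refl
  ∘ₛ-identityʳ Γ (σ ,, t) = cong₂ _,,_ (∘ₛ-identityʳ Γ σ) ([]t-idS Γ t)

  ScopedSub-idS : ∀ Γ → ScopedSub (len Γ) (idS Γ)
  ScopedSub-idS ∅ = ⟨⟩ˢ
  ScopedSub-idS (Γ ▸ A) = ,,ˢ (ScopedSub-mono (n≤1+n _) (ScopedSub-idS Γ)) (varˢ ≤-refl)

  ∘ₛ-identityˡ : ∀ Γ γ → lenS γ ≡ len Γ → idS Γ ∘ₛ γ ≡ γ
  ∘ₛ-identityˡ ∅ ⟨⟩ _ = refl
  ∘ₛ-identityˡ (Γ ▸ A) (γ ,, t) eq = cong₂ _,,_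
    (trans (∘ₛ-extend (subst (λ n → ScopedSub n (idS Γ)) (sym eq') (ScopedSub-idS Γ))) (∘ₛ-identityˡ Γ γ eq'))
    (lookupS-top γ t eq')
    where eq' = suc-injective eq

  ∋⇒<len : ∀ {Γ i A} → Γ ∋ i ∶ A → i < len Γ
  ∋⇒<len here = ≤-refl
  ∋⇒<len (there p) = m<n⇒m<1+n (∋⇒<len p)

  ⊢T⇒⊢ : ∀ {Γ A} → Γ ⊢T A → Γ ⊢
  ⊢T⇒⊢ (⋆⊢ Γ⊢) = Γ⊢
  ⊢T⇒⊢ (Hom⊢ A⊢ _ _) = ⊢T⇒⊢ A⊢

  ⊢ₛ⇒⊢ : ∀ {Δ γ Γ} → Δ ⊢ₛ γ ∶ Γ → Δ ⊢
  ⊢ₛ⇒⊢ (⟨⟩⊢ Δ⊢) = Δ⊢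
  ⊢ₛ⇒⊢ (,,⊢ γ⊢ _ _) = ⊢ₛ⇒⊢ γ⊢

  ⊢ₛ⇒lenS : ∀ {Δ γ Γ} → Δ ⊢ₛ γ ∶ Γ → lenS γ ≡ len Γ
  ⊢ₛ⇒lenS (⟨⟩⊢ _) = refl
  ⊢ₛ⇒lenS (,,⊢ γ⊢ _ _) = cong suc (⊢ₛ⇒lenS γ⊢)

  ⊢T⇒Scoped : ∀ {Γ A} → Γ ⊢T A → ScopedTy (len Γ) A
  ⊢t⇒Scoped : ∀ {Γ t A} → Γ ⊢ t ∶ A → ScopedTm (len Γ) t
  ⊢ₛ⇒Scoped : ∀ {Δ γ Γ} → Δ ⊢ₛ γ ∶ Γ → ScopedSub (len Δ) γ
  ⊢T⇒Scoped (⋆⊢ _) = ⋆ˢ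
  ⊢T⇒Scoped (Hom⊢ A⊢ t⊢ u⊢) = Homˢ (⊢T⇒Scoped A⊢) (⊢t⇒Scoped t⊢) (⊢t⇒Scoped u⊢)
  ⊢t⇒Scoped (var⊢ _ p) = varˢ (∋⇒<len p)
  ⊢t⇒Scoped (op⊢ _ γ⊢) = opˢ (⊢ₛ⇒Scoped γ⊢)
  ⊢t⇒Scoped (coh⊢ _ γ⊢) = cohˢ (⊢ₛ⇒Scoped γ⊢)
  ⊢ₛ⇒Scoped (⟨⟩⊢ _) = ⟨⟩ˢ
  ⊢ₛ⇒Scoped (,,⊢ γ⊢ _ t⊢) = ,,ˢ (⊢ₛ⇒Scoped γ⊢) (⊢t⇒Scoped t⊢)

  ∋⇒Scoped : ∀ {Γ i A} → Γ ⊢ → Γ ∋ i ∶ A → ScopedTy (len Γ) A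
  ∋⇒Scoped (▸⊢ B⊢) here = ScopedTy-mono (n≤1+n _) (⊢T⇒Scoped B⊢)
  ∋⇒Scoped (▸⊢ B⊢) (there p) = ScopedTy-mono (n≤1+n _) (∋⇒Scoped (⊢T⇒⊢ B⊢) p)

  ScopedTy-lenS : ∀ {γ n A} → lenS γ ≡ n → ScopedTy n A → ScopedTy (lenS γ) A
  ScopedTy-lenS eq = subst (λ k → ScopedTy k _) (sym eq)

  ScopedTm-lenS : ∀ {γ n t} → lenS γ ≡ n → ScopedTm n t → ScopedTm (lenS γ) t
  ScopedTm-lenS eq = subst (λ k → ScopedTm k _) (sym eq)

  ScopedSub-lenS : ∀ {γ n σ} → lenS γ ≡ n → ScopedSub n σ → ScopedSub (lenS γ) σ
  ScopedSub-lenS eq = subst (λ k → ScopedSub k _) (sym eq)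

  IsOpTy⇒⊢T : ∀ {Θ A} → IsOpTy Θ A → Θ ⊢T A
  IsOpTy⇒⊢T (isOp _ _ A⊢ _ _) = A⊢

  IsCohTy⇒⊢T : ∀ {Θ A} → IsCohTy Θ A → Θ ⊢T A
  IsCohTy⇒⊢T (isCoh _ A⊢ _ _) = A⊢

  []T-∘ₛ-⊢ₛ : ∀ {Δ Θ γ δ A} → Θ ⊢T A → Δ ⊢ₛ γ ∶ Θ → A [ γ ]T [ δ ]T ≡ A [ γ ∘ₛ δ ]T
  []T-∘ₛ-⊢ₛ A⊢ γ⊢ = []T-∘ₛ (ScopedTy-lenS (⊢ₛ⇒lenS γ⊢) (⊢T⇒Scoped A⊢))

  lookupS-⊢ : ∀ {Δ σ Γ i A} → Δ ⊢ₛ σ ∶ Γ → Γ ∋ i ∶ A → Δ ⊢ lookupS σ i ∶ (A [ σ ]T)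
  lookupS-⊢ {Δ} (,,⊢ {γ = γ} {t = t} γ⊢ B⊢ t⊢) here =
    subst₂ (λ u T → Δ ⊢ u ∶ T) (sym (lookupS-top γ t (⊢ₛ⇒lenS γ⊢)))
      (sym ([]T-extend (ScopedTy-lenS (⊢ₛ⇒lenS γ⊢) (⊢T⇒Scoped B⊢)))) t⊢
  lookupS-⊢ {Δ} (,,⊢ {γ = γ} {t = t} γ⊢ B⊢ t⊢) (there p) =
    subst₂ (λ u T → Δ ⊢ u ∶ T) (sym (lookupS-pop γ t (subst (_ <_) (sym (⊢ₛ⇒lenS γ⊢)) (∋⇒<len p))))
      (sym ([]T-extend (ScopedTy-lenS (⊢ₛ⇒lenS γ⊢) (∋⇒Scoped (⊢T⇒⊢ B⊢) p)))) (lookupS-⊢ γ⊢ p)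

  ⊢T-[] : ∀ {Δ σ Γ A} → Δ ⊢ₛ σ ∶ Γ → Γ ⊢T A → Δ ⊢T (A [ σ ]T)
  ⊢t-[] : ∀ {Δ σ Γ t A} → Δ ⊢ₛ σ ∶ Γ → Γ ⊢ t ∶ A → Δ ⊢ (t [ σ ]t) ∶ (A [ σ ]T)
  ⊢ₛ-∘ₛ : ∀ {Δ σ Γ γ Θ} → Γ ⊢ₛ γ ∶ Θ → Δ ⊢ₛ σ ∶ Γ → Δ ⊢ₛ (γ ∘ₛ σ) ∶ Θ
  ⊢T-[] σ⊢ (⋆⊢ _) = ⋆⊢ (⊢ₛ⇒⊢ σ⊢)
  ⊢T-[] σ⊢ (Hom⊢ A⊢ t⊢ u⊢) = Hom⊢ (⊢T-[] σ⊢ A⊢) (⊢t-[] σ⊢ t⊢) (⊢t-[] σ⊢ u⊢)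
  ⊢t-[] σ⊢ (var⊢ _ p) = lookupS-⊢ σ⊢ p
  ⊢t-[] {Δ} σ⊢ (op⊢ {Θ = Θ} {A} {γ} A-op γ⊢) =
    subst (λ T → Δ ⊢ op Θ A (γ ∘ₛ _) ∶ T) (sym ([]T-∘ₛ-⊢ₛ (IsOpTy⇒⊢T A-op) γ⊢)) (op⊢ A-op (⊢ₛ-∘ₛ γ⊢ σ⊢))
  ⊢t-[] {Δ} σ⊢ (coh⊢ {Θ = Θ} {A} {γ} A-coh γ⊢) =
    subst (λ T → Δ ⊢ coh Θ A (γ ∘ₛ _) ∶ T) (sym ([]T-∘ₛ-⊢ₛ (IsCohTy⇒⊢T A-coh) γ⊢)) (coh⊢ A-coh (⊢ₛ-∘ₛ γ⊢ σ⊢))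
  ⊢ₛ-∘ₛ (⟨⟩⊢ _) σ⊢ = ⟨⟩⊢ (⊢ₛ⇒⊢ σ⊢)
  ⊢ₛ-∘ₛ {Δ} {σ} (,,⊢ {t = t} γ⊢ B⊢ t⊢) σ⊢ =
    ,,⊢ (⊢ₛ-∘ₛ γ⊢ σ⊢) B⊢ (subst (λ T → Δ ⊢ t [ σ ]t ∶ T) ([]T-∘ₛ-⊢ₛ B⊢ γ⊢) (⊢t-[] σ⊢ t⊢))

  ⊢t-weaken : ∀ {Γ B t A} → (Γ ▸ B) ⊢ → Γ ⊢ t ∶ A → (Γ ▸ B) ⊢ t ∶ A
  ⊢ₛ-weaken : ∀ {Γ B γ Θ} → (Γ ▸ B) ⊢ → Γ ⊢ₛ γ ∶ Θ → (Γ ▸ B) ⊢ₛ γ ∶ Θ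
  ⊢t-weaken Γ▸B⊢ (var⊢ _ p) = var⊢ Γ▸B⊢ (there p)
  ⊢t-weaken Γ▸B⊢ (op⊢ A-op γ⊢) = op⊢ A-op (⊢ₛ-weaken Γ▸B⊢ γ⊢)
  ⊢t-weaken Γ▸B⊢ (coh⊢ A-coh γ⊢) = coh⊢ A-coh (⊢ₛ-weaken Γ▸B⊢ γ⊢)
  ⊢ₛ-weaken Γ▸B⊢ (⟨⟩⊢ _) = ⟨⟩⊢ Γ▸B⊢
  ⊢ₛ-weaken Γ▸B⊢ (,,⊢ γ⊢ A⊢ t⊢) = ,,⊢ (⊢ₛ-weaken Γ▸B⊢ γ⊢) A⊢ (⊢t-weaken Γ▸B⊢ t⊢)

  ⊢ₛ-idS : ∀ {Γ} → Γ ⊢ → Γ ⊢ₛ idS Γ ∶ Γ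
  ⊢ₛ-idS ∅⊢ = ⟨⟩⊢ ∅⊢
  ⊢ₛ-idS {Γ ▸ A} (▸⊢ A⊢) =
    ,,⊢ (⊢ₛ-weaken (▸⊢ A⊢) (⊢ₛ-idS (⊢T⇒⊢ A⊢))) A⊢
        (subst (λ T → (Γ ▸ A) ⊢ var (len Γ) ∶ T) (sym ([]T-idS Γ A)) (var⊢ (▸⊢ A⊢) here))

module CP = C-Properties

module M-Properties where
  open M
  open MT

  data ScopedTy (n : ℕ) : Ty → Set
  data ScopedTm (n : ℕ) : Tm → Set
  data ScopedSub (n : ℕ) : Sub → Set

  data ScopedTy n where
    𝟙ˢ   : ScopedTy n 𝟙
    Homˢ : ∀ {A t u} → ScopedTy n A → ScopedTm n t → ScopedTm n u → ScopedTy n (Hom A t u)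

  data ScopedTm n where
    varˢ  : ∀ {i} → i < n → ScopedTm n (var i)
    ttˢ   : ScopedTm n tt
    mopˢ  : ∀ {Θ A γ} → ScopedSub n γ → ScopedTm n (mop Θ A γ)
    mcohˢ : ∀ {Θ A γ} → ScopedSub n γ → ScopedTm n (mcoh Θ A γ)

  data ScopedSub n where
    ⟨⟩ˢ : ScopedSub n ⟨⟩
    ,,ˢ : ∀ {γ t} → ScopedSub n γ → ScopedTm n t → ScopedSub n (γ ,, t)

  ScopedTy-mono  : ∀ {m n A} → m ≤ n → ScopedTy m A → ScopedTy n A
  ScopedTm-mono  : ∀ {m n t} → m ≤ n → ScopedTm m t → ScopedTm n t
  ScopedSub-mono : ∀ {m n γ} → m ≤ n → ScopedSub m γ → ScopedSub n γ
  ScopedTy-mono le 𝟙ˢ = 𝟙ˢ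
  ScopedTy-mono le (Homˢ a t u) = Homˢ (ScopedTy-mono le a) (ScopedTm-mono le t) (ScopedTm-mono le u)
  ScopedTm-mono le (varˢ i<m) = varˢ (≤-trans i<m le)
  ScopedTm-mono le ttˢ = ttˢ
  ScopedTm-mono le (mopˢ γ) = mopˢ (ScopedSub-mono le γ)
  ScopedTm-mono le (mcohˢ γ) = mcohˢ (ScopedSub-mono le γ)
  ScopedSub-mono le ⟨⟩ˢ = ⟨⟩ˢ
  ScopedSub-mono le (,,ˢ γ t) = ,,ˢ (ScopedSub-mono le γ) (ScopedTm-mono le t)

  ScopedTy-D  : ∀ {n A} → CP.ScopedTy n A → ScopedTy n (DT A)
  ScopedTm-D  : ∀ {n t} → CP.ScopedTm n t → ScopedTm n (Dt t)
  ScopedSub-D : ∀ {n γ} → CP.ScopedSub n γ → ScopedSub n (DS γ)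
  ScopedTy-D CP.⋆ˢ = 𝟙ˢ
  ScopedTy-D (CP.Homˢ a t u) = Homˢ (ScopedTy-D a) (ScopedTm-D t) (ScopedTm-D u)
  ScopedTm-D (CP.varˢ i<n) = varˢ i<n
  ScopedTm-D (CP.opˢ γ) = mopˢ (ScopedSub-D γ)
  ScopedTm-D (CP.cohˢ γ) = mcohˢ (ScopedSub-D γ)
  ScopedSub-D CP.⟨⟩ˢ = ⟨⟩ˢ
  ScopedSub-D (CP.,,ˢ γ t) = ,,ˢ (ScopedSub-D γ) (ScopedTm-D t)

  len-DC : ∀ Θ → len (DC Θ) ≡ C.len Θ
  len-DC C.∅ = refl
  len-DC (Θ C.▸ A) = cong suc (len-DC Θ)

  lenS-∘ₛ : ∀ γ δ → lenS (γ ∘ₛ δ) ≡ lenS γ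
  lenS-∘ₛ ⟨⟩ δ = refl
  lenS-∘ₛ (γ ,, t) δ = cong suc (lenS-∘ₛ γ δ)

  lookupS-top : ∀ {n} γ t → lenS γ ≡ n → lookupS (γ ,, t) n ≡ t
  lookupS-top γ t refl rewrite ≡ᵇ-refl (lenS γ) = refl

  lookupS-pop : ∀ {i} γ t → i < lenS γ → lookupS (γ ,, t) i ≡ lookupS γ i
  lookupS-pop γ t i<γ rewrite <⇒≡ᵇ-false i<γ = refl

  []T-extend : ∀ {γ u A} → ScopedTy (lenS γ) A → A [ γ ,, u ]T ≡ A [ γ ]T
  []t-extend : ∀ {γ u t} → ScopedTm (lenS γ) t → t [ γ ,, u ]t ≡ t [ γ ]t
  ∘ₛ-extend  : ∀ {γ u σ} → ScopedSub (lenS γ) σ → σ ∘ₛ (γ ,, u) ≡ σ ∘ₛ γ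
  []T-extend 𝟙ˢ = refl
  []T-extend (Homˢ a t u) = cong₃ Hom ([]T-extend a) ([]t-extend t) ([]t-extend u)
  []t-extend {γ} {u} (varˢ i<γ) = lookupS-pop γ u i<γ
  []t-extend ttˢ = refl
  []t-extend (mopˢ σ) = cong (mop _ _) (∘ₛ-extend σ)
  []t-extend (mcohˢ σ) = cong (mcoh _ _) (∘ₛ-extend σ)
  ∘ₛ-extend ⟨⟩ˢ = refl
  ∘ₛ-extend (,,ˢ σ t) = cong₂ _,,_ (∘ₛ-extend σ) ([]t-extend t)

  lookupS-∘ₛ : ∀ γ δ i → i < lenS γ → lookupS (γ ∘ₛ δ) i ≡ lookupS γ i [ δ ]t
  lookupS-∘ₛ (γ ,, t) δ i i<γ with m<1+n⇒m<n∨m≡n i<γ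
  ... | inj₂ refl = trans (lookupS-top (γ ∘ₛ δ) _ (lenS-∘ₛ γ δ)) (cong (_[ δ ]t) (sym (lookupS-top γ t refl)))
  ... | inj₁ i<γ' = begin
    lookupS ((γ ∘ₛ δ) ,, t [ δ ]t) i ≡⟨ lookupS-pop (γ ∘ₛ δ) _ (subst (i <_) (sym (lenS-∘ₛ γ δ)) i<γ') ⟩
    lookupS (γ ∘ₛ δ) i               ≡⟨ lookupS-∘ₛ γ δ i i<γ' ⟩
    lookupS γ i [ δ ]t               ≡⟨ cong (_[ δ ]t) (sym (lookupS-pop γ t i<γ')) ⟩
    lookupS (γ ,, t) i [ δ ]t        ∎
    where open ≡-Reasoning

  lookupS-Scoped : ∀ {n σ j} → ScopedSub n σ → j < lenS σ → ScopedTm n (lookupS σ j)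
  lookupS-Scoped {σ = γ ,, t} {j} (,,ˢ γˢ tˢ) j<σ with m<1+n⇒m<n∨m≡n j<σ
  ... | inj₂ refl = subst (ScopedTm _) (sym (lookupS-top γ t refl)) tˢ
  ... | inj₁ j<γ = subst (ScopedTm _) (sym (lookupS-pop γ t j<γ)) (lookupS-Scoped γˢ j<γ)

  []T-∘ₛ  : ∀ {γ δ A} → ScopedTy (lenS γ) A → A [ γ ]T [ δ ]T ≡ A [ γ ∘ₛ δ ]T
  []t-∘ₛ  : ∀ {γ δ t} → ScopedTm (lenS γ) t → t [ γ ]t [ δ ]t ≡ t [ γ ∘ₛ δ ]t
  ∘ₛ-assoc : ∀ {γ δ σ} → ScopedSub (lenS γ) σ → (σ ∘ₛ γ) ∘ₛ δ ≡ σ ∘ₛ (γ ∘ₛ δ)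
  []T-∘ₛ 𝟙ˢ = refl
  []T-∘ₛ (Homˢ a t u) = cong₃ Hom ([]T-∘ₛ a) ([]t-∘ₛ t) ([]t-∘ₛ u)
  []t-∘ₛ {γ} {δ} (varˢ {i} i<γ) = sym (lookupS-∘ₛ γ δ i i<γ)
  []t-∘ₛ ttˢ = refl
  []t-∘ₛ (mopˢ σ) = cong (mop _ _) (∘ₛ-assoc σ)
  []t-∘ₛ (mcohˢ σ) = cong (mcoh _ _) (∘ₛ-assoc σ)
  ∘ₛ-assoc ⟨⟩ˢ = refl
  ∘ₛ-assoc (,,ˢ σ t) = cong₂ _,,_ (∘ₛ-assoc σ) ([]t-∘ₛ t)

  lenS-idS : ∀ Γ → lenS (idS Γ) ≡ len Γ
  lenS-idS ∅ = refl
  lenS-idS (Γ ▸ A) = cong suc (lenS-idS Γ)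

  lookupS-idS : ∀ Γ i → lookupS (idS Γ) i ≡ var i
  lookupS-idS ∅ i = refl
  lookupS-idS (Γ ▸ A) i with i ≡ᵇ lenS (idS Γ) in eq
  ... | true = cong var (sym (trans (≡ᵇ⇒≡ i _ (subst T (sym eq) _)) (lenS-idS Γ)))
  ... | false = lookupS-idS Γ i

  []T-idS : ∀ Γ A → A [ idS Γ ]T ≡ A
  []t-idS : ∀ Γ t → t [ idS Γ ]t ≡ t
  ∘ₛ-identityʳ : ∀ Γ σ → σ ∘ₛ idS Γ ≡ σ
  []T-idS Γ 𝟙 = refl
  []T-idS Γ (Hom A t u) = cong₃ Hom ([]T-idS Γ A) ([]t-idS Γ t) ([]t-idS Γ u)
  []t-idS Γ (var i) = lookupS-idS Γ i
  []t-idS Γ tt = refl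
  []t-idS Γ (mop Θ A γ) = cong (mop Θ A) (∘ₛ-identityʳ Γ γ)
  []t-idS Γ (mcoh Θ A γ) = cong (mcoh Θ A) (∘ₛ-identityʳ Γ γ)
  ∘ₛ-identityʳ Γ ⟨⟩ = refl
  ∘ₛ-identityʳ Γ (σ ,, t) = cong₂ _,,_ (∘ₛ-identityʳ Γ σ) ([]t-idS Γ t)

  ScopedSub-idS : ∀ Γ → ScopedSub (len Γ) (idS Γ)
  ScopedSub-idS ∅ = ⟨⟩ˢ
  ScopedSub-idS (Γ ▸ A) = ,,ˢ (ScopedSub-mono (n≤1+n _) (ScopedSub-idS Γ)) (varˢ ≤-refl)

  ∘ₛ-identityˡ : ∀ Γ γ → lenS γ ≡ len Γ → idS Γ ∘ₛ γ ≡ γ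
  ∘ₛ-identityˡ ∅ ⟨⟩ _ = refl
  ∘ₛ-identityˡ (Γ ▸ A) (γ ,, t) eq = cong₂ _,,_
    (trans (∘ₛ-extend (subst (λ n → ScopedSub n (idS Γ)) (sym eq') (ScopedSub-idS Γ))) (∘ₛ-identityˡ Γ γ eq'))
    (lookupS-top γ t eq')
    where eq' = suc-injective eq

  ∋⇒<len : ∀ {Γ i A} → Γ ∋ i ∶ A → i < len Γ
  ∋⇒<len here = ≤-refl
  ∋⇒<len (there p) = m<n⇒m<1+n (∋⇒<len p)

  ⊢T⇒⊢ : ∀ {Γ A} → Γ ⊢T A → Γ ⊢
  ⊢T⇒⊢ (𝟙⊢ Γ⊢) = Γ⊢
  ⊢T⇒⊢ (Hom⊢ A⊢ _ _) = ⊢T⇒⊢ A⊢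

  ⊢ₛ⇒⊢ : ∀ {Δ γ Γ} → Δ ⊢ₛ γ ∶ Γ → Δ ⊢
  ⊢ₛ⇒⊢ (⟨⟩⊢ Δ⊢) = Δ⊢
  ⊢ₛ⇒⊢ (,,⊢ γ⊢ _ _) = ⊢ₛ⇒⊢ γ⊢

  ⊢ₛ⇒lenS : ∀ {Δ γ Γ} → Δ ⊢ₛ γ ∶ Γ → lenS γ ≡ len Γ
  ⊢ₛ⇒lenS (⟨⟩⊢ _) = refl
  ⊢ₛ⇒lenS (,,⊢ γ⊢ _ _) = cong suc (⊢ₛ⇒lenS γ⊢)

  ≣ₛ⇒lenSˡ : ∀ {Δ γ δ Γ} → Δ ⊢ₛ γ ≣ δ ∶ Γ → lenS γ ≡ len Γ
  ≣ₛ⇒lenSˡ (⟨⟩≣ _) = refl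
  ≣ₛ⇒lenSˡ (,,≣ γ≣δ _ _) = cong suc (≣ₛ⇒lenSˡ γ≣δ)

  ≣ₛ⇒lenSʳ : ∀ {Δ γ δ Γ} → Δ ⊢ₛ γ ≣ δ ∶ Γ → lenS δ ≡ len Γ
  ≣ₛ⇒lenSʳ (⟨⟩≣ _) = refl
  ≣ₛ⇒lenSʳ (,,≣ γ≣δ _ _) = cong suc (≣ₛ⇒lenSʳ γ≣δ)

  ⊢T⇒Scoped : ∀ {Γ A} → Γ ⊢T A → ScopedTy (len Γ) A
  ⊢t⇒Scoped : ∀ {Γ t A} → Γ ⊢ t ∶ A → ScopedTm (len Γ) t
  ⊢ₛ⇒Scoped : ∀ {Δ γ Γ} → Δ ⊢ₛ γ ∶ Γ → ScopedSub (len Δ) γ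
  ⊢T⇒Scoped (𝟙⊢ _) = 𝟙ˢ
  ⊢T⇒Scoped (Hom⊢ A⊢ t⊢ u⊢) = Homˢ (⊢T⇒Scoped A⊢) (⊢t⇒Scoped t⊢) (⊢t⇒Scoped u⊢)
  ⊢t⇒Scoped (var⊢ _ p) = varˢ (∋⇒<len p)
  ⊢t⇒Scoped (tt⊢ _) = ttˢ
  ⊢t⇒Scoped (mop⊢ _ γ⊢) = mopˢ (⊢ₛ⇒Scoped γ⊢)
  ⊢t⇒Scoped (mcoh⊢ _ γ⊢) = mcohˢ (⊢ₛ⇒Scoped γ⊢)
  ⊢t⇒Scoped (conv⊢ t⊢ _) = ⊢t⇒Scoped t⊢
  ⊢ₛ⇒Scoped (⟨⟩⊢ _) = ⟨⟩ˢ
  ⊢ₛ⇒Scoped (,,⊢ γ⊢ _ t⊢) = ,,ˢ (⊢ₛ⇒Scoped γ⊢) (⊢t⇒Scoped t⊢)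

  ∋⇒Scoped : ∀ {Γ i A} → Γ ⊢ → Γ ∋ i ∶ A → ScopedTy (len Γ) A
  ∋⇒Scoped (▸⊢ B⊢) here = ScopedTy-mono (n≤1+n _) (⊢T⇒Scoped B⊢)
  ∋⇒Scoped (▸⊢ B⊢) (there p) = ScopedTy-mono (n≤1+n _) (∋⇒Scoped (⊢T⇒⊢ B⊢) p)

  ScopedTy-lenS : ∀ {γ n A} → lenS γ ≡ n → ScopedTy n A → ScopedTy (lenS γ) A
  ScopedTy-lenS eq = subst (λ k → ScopedTy k _) (sym eq)

  ScopedTm-lenS : ∀ {γ n t} → lenS γ ≡ n → ScopedTm n t → ScopedTm (lenS γ) t
  ScopedTm-lenS eq = subst (λ k → ScopedTm k _) (sym eq)

  ScopedSub-lenS : ∀ {γ n σ} → lenS γ ≡ n → ScopedSub n σ → ScopedSub (lenS γ) σ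
  ScopedSub-lenS eq = subst (λ k → ScopedSub k _) (sym eq)

  []T-∘ₛ-len : ∀ {Γ γ δ A} → Γ ⊢T A → lenS γ ≡ len Γ → A [ γ ]T [ δ ]T ≡ A [ γ ∘ₛ δ ]T
  []T-∘ₛ-len A⊢ eq = []T-∘ₛ (ScopedTy-lenS eq (⊢T⇒Scoped A⊢))

  D[]T-∘ₛ-len : ∀ {Θ γ δ A} → Θ C.⊢T A → lenS γ ≡ len (DC Θ) → DT A [ γ ]T [ δ ]T ≡ DT A [ γ ∘ₛ δ ]T
  D[]T-∘ₛ-len {Θ} A⊢ eq = []T-∘ₛ (ScopedTy-lenS (trans eq (len-DC Θ)) (ScopedTy-D (CP.⊢T⇒Scoped A⊢)))

  lookupS-⊢ : ∀ {Δ σ Γ i A} → Δ ⊢ₛ σ ∶ Γ → Γ ∋ i ∶ A → Δ ⊢ lookupS σ i ∶ (A [ σ ]T)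
  lookupS-⊢ {Δ} (,,⊢ {γ = γ} {t = t} γ⊢ B⊢ t⊢) here =
    subst₂ (λ u T → Δ ⊢ u ∶ T) (sym (lookupS-top γ t (⊢ₛ⇒lenS γ⊢)))
      (sym ([]T-extend (ScopedTy-lenS (⊢ₛ⇒lenS γ⊢) (⊢T⇒Scoped B⊢)))) t⊢
  lookupS-⊢ {Δ} (,,⊢ {γ = γ} {t = t} γ⊢ B⊢ t⊢) (there p) =
    subst₂ (λ u T → Δ ⊢ u ∶ T) (sym (lookupS-pop γ t (subst (_ <_) (sym (⊢ₛ⇒lenS γ⊢)) (∋⇒<len p))))
      (sym ([]T-extend (ScopedTy-lenS (⊢ₛ⇒lenS γ⊢) (∋⇒Scoped (⊢T⇒⊢ B⊢) p)))) (lookupS-⊢ γ⊢ p)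

  ⊢T-[] : ∀ {Δ σ Γ A} → Δ ⊢ₛ σ ∶ Γ → Γ ⊢T A → Δ ⊢T (A [ σ ]T)
  ⊢t-[] : ∀ {Δ σ Γ t A} → Δ ⊢ₛ σ ∶ Γ → Γ ⊢ t ∶ A → Δ ⊢ (t [ σ ]t) ∶ (A [ σ ]T)
  ⊢ₛ-∘ₛ : ∀ {Δ σ Γ γ Θ} → Γ ⊢ₛ γ ∶ Θ → Δ ⊢ₛ σ ∶ Γ → Δ ⊢ₛ (γ ∘ₛ σ) ∶ Θ
  ≣T-[] : ∀ {Δ σ Γ A B} → Δ ⊢ₛ σ ∶ Γ → Γ ⊢ A ≣T B → Δ ⊢ (A [ σ ]T) ≣T (B [ σ ]T)
  ≣t-[] : ∀ {Δ σ Γ t u A} → Δ ⊢ₛ σ ∶ Γ → Γ ⊢ t ≣ u ∶ A → Δ ⊢ (t [ σ ]t) ≣ (u [ σ ]t) ∶ (A [ σ ]T)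
  ≣ₛ-∘ₛ : ∀ {Δ σ Γ γ δ Θ} → Γ ⊢ₛ γ ≣ δ ∶ Θ → Δ ⊢ₛ σ ∶ Γ → Δ ⊢ₛ (γ ∘ₛ σ) ≣ (δ ∘ₛ σ) ∶ Θ
  ⊢T-[] σ⊢ (𝟙⊢ _) = 𝟙⊢ (⊢ₛ⇒⊢ σ⊢)
  ⊢T-[] σ⊢ (Hom⊢ A⊢ t⊢ u⊢) = Hom⊢ (⊢T-[] σ⊢ A⊢) (⊢t-[] σ⊢ t⊢) (⊢t-[] σ⊢ u⊢)
  ⊢t-[] σ⊢ (var⊢ _ p) = lookupS-⊢ σ⊢ p
  ⊢t-[] σ⊢ (tt⊢ _) = tt⊢ (⊢ₛ⇒⊢ σ⊢)
  ⊢t-[] {Δ} σ⊢ (mop⊢ {Θ = Θ} {A} {γ} A-op γ⊢) =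
    subst (λ T → Δ ⊢ mop Θ A (γ ∘ₛ _) ∶ T) (sym (D[]T-∘ₛ-len (CP.IsOpTy⇒⊢T A-op) (⊢ₛ⇒lenS γ⊢))) (mop⊢ A-op (⊢ₛ-∘ₛ γ⊢ σ⊢))
  ⊢t-[] {Δ} σ⊢ (mcoh⊢ {Θ = Θ} {A} {γ} A-coh γ⊢) =
    subst (λ T → Δ ⊢ mcoh Θ A (γ ∘ₛ _) ∶ T) (sym (D[]T-∘ₛ-len (CP.IsCohTy⇒⊢T A-coh) (⊢ₛ⇒lenS γ⊢))) (mcoh⊢ A-coh (⊢ₛ-∘ₛ γ⊢ σ⊢))
  ⊢t-[] σ⊢ (conv⊢ t⊢ A≣B) = conv⊢ (⊢t-[] σ⊢ t⊢) (≣T-[] σ⊢ A≣B)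
  ⊢ₛ-∘ₛ (⟨⟩⊢ _) σ⊢ = ⟨⟩⊢ (⊢ₛ⇒⊢ σ⊢)
  ⊢ₛ-∘ₛ {Δ} {σ} (,,⊢ {t = t} γ⊢ B⊢ t⊢) σ⊢ =
    ,,⊢ (⊢ₛ-∘ₛ γ⊢ σ⊢) B⊢ (subst (λ T → Δ ⊢ t [ σ ]t ∶ T) ([]T-∘ₛ-len B⊢ (⊢ₛ⇒lenS γ⊢)) (⊢t-[] σ⊢ t⊢))
  ≣T-[] σ⊢ (𝟙≣ _) = 𝟙≣ (⊢ₛ⇒⊢ σ⊢)
  ≣T-[] σ⊢ (Hom≣ A≣ t≣ u≣) = Hom≣ (≣T-[] σ⊢ A≣) (≣t-[] σ⊢ t≣) (≣t-[] σ⊢ u≣)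
  ≣T-[] σ⊢ (symT A≣B) = symT (≣T-[] σ⊢ A≣B)
  ≣T-[] σ⊢ (transT A≣B B≣C) = transT (≣T-[] σ⊢ A≣B) (≣T-[] σ⊢ B≣C)
  ≣t-[] σ⊢ (refl≣ t⊢) = refl≣ (⊢t-[] σ⊢ t⊢)
  ≣t-[] σ⊢ (sym≣ t≣u) = sym≣ (≣t-[] σ⊢ t≣u)
  ≣t-[] σ⊢ (trans≣ t≣u u≣v) = trans≣ (≣t-[] σ⊢ t≣u) (≣t-[] σ⊢ u≣v)
  ≣t-[] σ⊢ (conv≣ t≣u A≣B) = conv≣ (≣t-[] σ⊢ t≣u) (≣T-[] σ⊢ A≣B)
  ≣t-[] σ⊢ (η𝟙 t⊢) = η𝟙 (⊢t-[] σ⊢ t⊢)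
  ≣t-[] {Δ} σ⊢ (mop≣ {Θ = Θ} {A} {γ} {δ} A-op γ≣δ) =
    subst (λ T → Δ ⊢ mop Θ A (γ ∘ₛ _) ≣ mop Θ A (δ ∘ₛ _) ∶ T)
      (sym (D[]T-∘ₛ-len (CP.IsOpTy⇒⊢T A-op) (≣ₛ⇒lenSˡ γ≣δ))) (mop≣ A-op (≣ₛ-∘ₛ γ≣δ σ⊢))
  ≣t-[] {Δ} σ⊢ (mcoh≣ {Θ = Θ} {A} {γ} {δ} A-coh γ≣δ) =
    subst (λ T → Δ ⊢ mcoh Θ A (γ ∘ₛ _) ≣ mcoh Θ A (δ ∘ₛ _) ∶ T)
      (sym (D[]T-∘ₛ-len (CP.IsCohTy⇒⊢T A-coh) (≣ₛ⇒lenSˡ γ≣δ))) (mcoh≣ A-coh (≣ₛ-∘ₛ γ≣δ σ⊢))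
  ≣ₛ-∘ₛ (⟨⟩≣ _) σ⊢ = ⟨⟩≣ (⊢ₛ⇒⊢ σ⊢)
  ≣ₛ-∘ₛ {Δ} {σ} (,,≣ {t = t} {u = u} γ≣δ B⊢ t≣u) σ⊢ =
    ,,≣ (≣ₛ-∘ₛ γ≣δ σ⊢) B⊢ (subst (λ T → Δ ⊢ t [ σ ]t ≣ u [ σ ]t ∶ T) ([]T-∘ₛ-len B⊢ (≣ₛ⇒lenSˡ γ≣δ)) (≣t-[] σ⊢ t≣u))

  ⊢t-weaken : ∀ {Γ B t A} → (Γ ▸ B) ⊢ → Γ ⊢ t ∶ A → (Γ ▸ B) ⊢ t ∶ A
  ⊢ₛ-weaken : ∀ {Γ B γ Θ} → (Γ ▸ B) ⊢ → Γ ⊢ₛ γ ∶ Θ → (Γ ▸ B) ⊢ₛ γ ∶ Θ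
  ≣T-weaken : ∀ {Γ B A A'} → (Γ ▸ B) ⊢ → Γ ⊢ A ≣T A' → (Γ ▸ B) ⊢ A ≣T A'
  ≣t-weaken : ∀ {Γ B t u A} → (Γ ▸ B) ⊢ → Γ ⊢ t ≣ u ∶ A → (Γ ▸ B) ⊢ t ≣ u ∶ A
  ≣ₛ-weaken : ∀ {Γ B γ δ Θ} → (Γ ▸ B) ⊢ → Γ ⊢ₛ γ ≣ δ ∶ Θ → (Γ ▸ B) ⊢ₛ γ ≣ δ ∶ Θ
  ⊢t-weaken Γ▸B⊢ (var⊢ _ p) = var⊢ Γ▸B⊢ (there p)
  ⊢t-weaken Γ▸B⊢ (tt⊢ _) = tt⊢ Γ▸B⊢
  ⊢t-weaken Γ▸B⊢ (mop⊢ A-op γ⊢) = mop⊢ A-op (⊢ₛ-weaken Γ▸B⊢ γ⊢)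
  ⊢t-weaken Γ▸B⊢ (mcoh⊢ A-coh γ⊢) = mcoh⊢ A-coh (⊢ₛ-weaken Γ▸B⊢ γ⊢)
  ⊢t-weaken Γ▸B⊢ (conv⊢ t⊢ A≣B) = conv⊢ (⊢t-weaken Γ▸B⊢ t⊢) (≣T-weaken Γ▸B⊢ A≣B)
  ⊢ₛ-weaken Γ▸B⊢ (⟨⟩⊢ _) = ⟨⟩⊢ Γ▸B⊢
  ⊢ₛ-weaken Γ▸B⊢ (,,⊢ γ⊢ A⊢ t⊢) = ,,⊢ (⊢ₛ-weaken Γ▸B⊢ γ⊢) A⊢ (⊢t-weaken Γ▸B⊢ t⊢)
  ≣T-weaken Γ▸B⊢ (𝟙≣ _) = 𝟙≣ Γ▸B⊢
  ≣T-weaken Γ▸B⊢ (Hom≣ A≣ t≣ u≣) = Hom≣ (≣T-weaken Γ▸B⊢ A≣) (≣t-weaken Γ▸B⊢ t≣) (≣t-weaken Γ▸B⊢ u≣)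
  ≣T-weaken Γ▸B⊢ (symT A≣B) = symT (≣T-weaken Γ▸B⊢ A≣B)
  ≣T-weaken Γ▸B⊢ (transT A≣B B≣C) = transT (≣T-weaken Γ▸B⊢ A≣B) (≣T-weaken Γ▸B⊢ B≣C)
  ≣t-weaken Γ▸B⊢ (refl≣ t⊢) = refl≣ (⊢t-weaken Γ▸B⊢ t⊢)
  ≣t-weaken Γ▸B⊢ (sym≣ t≣u) = sym≣ (≣t-weaken Γ▸B⊢ t≣u)
  ≣t-weaken Γ▸B⊢ (trans≣ t≣u u≣v) = trans≣ (≣t-weaken Γ▸B⊢ t≣u) (≣t-weaken Γ▸B⊢ u≣v)
  ≣t-weaken Γ▸B⊢ (conv≣ t≣u A≣B) = conv≣ (≣t-weaken Γ▸B⊢ t≣u) (≣T-weaken Γ▸B⊢ A≣B)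
  ≣t-weaken Γ▸B⊢ (η𝟙 t⊢) = η𝟙 (⊢t-weaken Γ▸B⊢ t⊢)
  ≣t-weaken Γ▸B⊢ (mop≣ A-op γ≣δ) = mop≣ A-op (≣ₛ-weaken Γ▸B⊢ γ≣δ)
  ≣t-weaken Γ▸B⊢ (mcoh≣ A-coh γ≣δ) = mcoh≣ A-coh (≣ₛ-weaken Γ▸B⊢ γ≣δ)
  ≣ₛ-weaken Γ▸B⊢ (⟨⟩≣ _) = ⟨⟩≣ Γ▸B⊢
  ≣ₛ-weaken Γ▸B⊢ (,,≣ γ≣δ A⊢ t≣u) = ,,≣ (≣ₛ-weaken Γ▸B⊢ γ≣δ) A⊢ (≣t-weaken Γ▸B⊢ t≣u)

  ⊢ₛ-idS : ∀ {Γ} → Γ ⊢ → Γ ⊢ₛ idS Γ ∶ Γ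
  ⊢ₛ-idS ∅⊢ = ⟨⟩⊢ ∅⊢
  ⊢ₛ-idS {Γ ▸ A} (▸⊢ A⊢) =
    ,,⊢ (⊢ₛ-weaken (▸⊢ A⊢) (⊢ₛ-idS (⊢T⇒⊢ A⊢))) A⊢
        (subst (λ T → (Γ ▸ A) ⊢ var (len Γ) ∶ T) (sym ([]T-idS Γ A)) (var⊢ (▸⊢ A⊢) here))

  ≣ₛ-refl : ∀ {Δ γ Γ} → Δ ⊢ₛ γ ∶ Γ → Δ ⊢ₛ γ ≣ γ ∶ Γ
  ≣ₛ-refl (⟨⟩⊢ Δ⊢) = ⟨⟩≣ Δ⊢
  ≣ₛ-refl (,,⊢ γ⊢ B⊢ t⊢) = ,,≣ (≣ₛ-refl γ⊢) B⊢ (refl≣ t⊢)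

  ≡⇒≣ₛ : ∀ {Δ γ δ Γ} → Δ ⊢ₛ γ ∶ Γ → γ ≡ δ → Δ ⊢ₛ γ ≣ δ ∶ Γ
  ≡⇒≣ₛ γ⊢ refl = ≣ₛ-refl γ⊢

  lookupS-resp-≣ₛ : ∀ {Δ γ δ Γ i A} → Δ ⊢ₛ γ ∶ Γ → Δ ⊢ₛ γ ≣ δ ∶ Γ → Γ ∋ i ∶ A →
                    Δ ⊢ lookupS γ i ≣ lookupS δ i ∶ (A [ γ ]T)
  lookupS-resp-≣ₛ {Δ} (,,⊢ _ _ _) (,,≣ {γ = γ} {δ} {t = t} {u} γ≣δ B⊢ t≣u) here =
    subst₂ (λ x T → Δ ⊢ x ≣ lookupS (δ ,, u) _ ∶ T)
      (sym (lookupS-top γ t (≣ₛ⇒lenSˡ γ≣δ))) (sym ([]T-extend (ScopedTy-lenS (≣ₛ⇒lenSˡ γ≣δ) (⊢T⇒Scoped B⊢))))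
      (subst (λ y → Δ ⊢ t ≣ y ∶ _) (sym (lookupS-top δ u (≣ₛ⇒lenSʳ γ≣δ))) t≣u)
  lookupS-resp-≣ₛ {Δ} (,,⊢ γ⊢ _ _) (,,≣ {γ = γ} {δ} {t = t} {u} γ≣δ B⊢ t≣u) (there p) =
    subst₂ (λ x T → Δ ⊢ x ≣ lookupS (δ ,, u) _ ∶ T)
      (sym (lookupS-pop γ t (subst (_ <_) (sym (≣ₛ⇒lenSˡ γ≣δ)) (∋⇒<len p))))
      (sym ([]T-extend (ScopedTy-lenS (≣ₛ⇒lenSˡ γ≣δ) (∋⇒Scoped (⊢T⇒⊢ B⊢) p))))
      (subst (λ y → Δ ⊢ _ ≣ y ∶ _) (sym (lookupS-pop δ u (subst (_ <_) (sym (≣ₛ⇒lenSʳ γ≣δ)) (∋⇒<len p))))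
        (lookupS-resp-≣ₛ γ⊢ γ≣δ p))

  []T-resp-≣ₛ : ∀ {Δ γ δ Γ A} → Δ ⊢ₛ γ ∶ Γ → Δ ⊢ₛ γ ≣ δ ∶ Γ → Γ ⊢T A → Δ ⊢ (A [ γ ]T) ≣T (A [ δ ]T)
  []t-resp-≣ₛ : ∀ {Δ γ δ Γ t A} → Δ ⊢ₛ γ ∶ Γ → Δ ⊢ₛ γ ≣ δ ∶ Γ → Γ ⊢ t ∶ A →
                Δ ⊢ (t [ γ ]t) ≣ (t [ δ ]t) ∶ (A [ γ ]T)
  ∘ₛ-resp-≣ₛ : ∀ {Δ γ δ Γ ρ Θ} → Δ ⊢ₛ γ ∶ Γ → Δ ⊢ₛ γ ≣ δ ∶ Γ → Γ ⊢ₛ ρ ∶ Θ → Δ ⊢ₛ (ρ ∘ₛ γ) ≣ (ρ ∘ₛ δ) ∶ Θ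
  []T-resp-≣ₛ γ⊢ γ≣δ (𝟙⊢ _) = 𝟙≣ (⊢ₛ⇒⊢ γ⊢)
  []T-resp-≣ₛ γ⊢ γ≣δ (Hom⊢ A⊢ t⊢ u⊢) =
    Hom≣ ([]T-resp-≣ₛ γ⊢ γ≣δ A⊢) ([]t-resp-≣ₛ γ⊢ γ≣δ t⊢) ([]t-resp-≣ₛ γ⊢ γ≣δ u⊢)
  []t-resp-≣ₛ γ⊢ γ≣δ (var⊢ _ p) = lookupS-resp-≣ₛ γ⊢ γ≣δ p
  []t-resp-≣ₛ γ⊢ γ≣δ (tt⊢ _) = refl≣ (tt⊢ (⊢ₛ⇒⊢ γ⊢))
  []t-resp-≣ₛ {Δ} {γ} {δ} γ⊢ γ≣δ (mop⊢ {Θ = Θ} {A} {ρ} A-op ρ⊢) =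
    subst (λ T → Δ ⊢ mop Θ A (ρ ∘ₛ γ) ≣ mop Θ A (ρ ∘ₛ δ) ∶ T)
      (sym (D[]T-∘ₛ-len (CP.IsOpTy⇒⊢T A-op) (⊢ₛ⇒lenS ρ⊢))) (mop≣ A-op (∘ₛ-resp-≣ₛ γ⊢ γ≣δ ρ⊢))
  []t-resp-≣ₛ {Δ} {γ} {δ} γ⊢ γ≣δ (mcoh⊢ {Θ = Θ} {A} {ρ} A-coh ρ⊢) =
    subst (λ T → Δ ⊢ mcoh Θ A (ρ ∘ₛ γ) ≣ mcoh Θ A (ρ ∘ₛ δ) ∶ T)
      (sym (D[]T-∘ₛ-len (CP.IsCohTy⇒⊢T A-coh) (⊢ₛ⇒lenS ρ⊢))) (mcoh≣ A-coh (∘ₛ-resp-≣ₛ γ⊢ γ≣δ ρ⊢))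
  []t-resp-≣ₛ γ⊢ γ≣δ (conv⊢ t⊢ A≣B) = conv≣ ([]t-resp-≣ₛ γ⊢ γ≣δ t⊢) (≣T-[] γ⊢ A≣B)
  ∘ₛ-resp-≣ₛ γ⊢ γ≣δ (⟨⟩⊢ _) = ⟨⟩≣ (⊢ₛ⇒⊢ γ⊢)
  ∘ₛ-resp-≣ₛ {Δ} {γ} {δ} γ⊢ γ≣δ (,,⊢ {t = t} ρ⊢ B⊢ t⊢) =
    ,,≣ (∘ₛ-resp-≣ₛ γ⊢ γ≣δ ρ⊢) B⊢
      (subst (λ T → Δ ⊢ t [ γ ]t ≣ t [ δ ]t ∶ T) ([]T-∘ₛ-len B⊢ (⊢ₛ⇒lenS ρ⊢)) ([]t-resp-≣ₛ γ⊢ γ≣δ t⊢))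

  ≣ₛ-sym : ∀ {Δ γ δ Γ} → Δ ⊢ₛ γ ∶ Γ → Δ ⊢ₛ γ ≣ δ ∶ Γ → Δ ⊢ₛ δ ≣ γ ∶ Γ
  ≣ₛ-sym _ (⟨⟩≣ Δ⊢) = ⟨⟩≣ Δ⊢
  ≣ₛ-sym (,,⊢ γ⊢ _ _) (,,≣ γ≣δ B⊢ t≣u) = ,,≣ (≣ₛ-sym γ⊢ γ≣δ) B⊢ (conv≣ (sym≣ t≣u) ([]T-resp-≣ₛ γ⊢ γ≣δ B⊢))

  ≣ₛ-trans : ∀ {Δ γ δ σ Γ} → Δ ⊢ₛ γ ∶ Γ → Δ ⊢ₛ γ ≣ δ ∶ Γ → Δ ⊢ₛ δ ≣ σ ∶ Γ → Δ ⊢ₛ γ ≣ σ ∶ Γ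
  ≣ₛ-trans _ (⟨⟩≣ Δ⊢) (⟨⟩≣ _) = ⟨⟩≣ Δ⊢
  ≣ₛ-trans (,,⊢ γ⊢ _ _) (,,≣ γ≣δ B⊢ t≣u) (,,≣ δ≣σ _ u≣v) =
    ,,≣ (≣ₛ-trans γ⊢ γ≣δ δ≣σ) B⊢ (trans≣ t≣u (conv≣ u≣v (symT ([]T-resp-≣ₛ γ⊢ γ≣δ B⊢))))

module MP = M-Properties

CaTT-isSynCat : IsSynCat CaTT
CaTT-isSynCat = record
  { id-wf = CP.⊢ₛ-idS
  ; ∘-wf = CP.⊢ₛ-∘ₛ
  ; ≈-refl = λ _ → refl
  ; ≈-sym = λ _ _ → sym
  ; ≈-trans = λ _ _ _ → trans
  ; ∘-resp = λ _ _ _ _ → cong₂ C._∘ₛ_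
  ; assoc = λ γ⊢ δ⊢ _ → CP.∘ₛ-assoc (CP.ScopedSub-lenS (CP.⊢ₛ⇒lenS δ⊢) (CP.⊢ₛ⇒Scoped γ⊢))
  ; idˡ = λ _ _ γ⊢ → CP.∘ₛ-identityˡ _ _ (CP.⊢ₛ⇒lenS γ⊢)
  ; idʳ = λ _ _ _ → CP.∘ₛ-identityʳ _ _
  }

MCaTT-isSynCat : IsSynCat MCaTT
MCaTT-isSynCat = record
  { id-wf = MP.⊢ₛ-idS
  ; ∘-wf = MP.⊢ₛ-∘ₛ
  ; ≈-refl = MP.≣ₛ-refl
  ; ≈-sym = λ γ⊢ _ → MP.≣ₛ-sym γ⊢
  ; ≈-trans = λ γ⊢ _ _ → MP.≣ₛ-trans γ⊢
  ; ∘-resp = λ γ⊢ γ'⊢ δ⊢ _ γ≣γ' δ≣δ' →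
      MP.≣ₛ-trans (MP.⊢ₛ-∘ₛ γ⊢ δ⊢) (MP.≣ₛ-∘ₛ γ≣γ' δ⊢) (MP.∘ₛ-resp-≣ₛ δ⊢ δ≣δ' γ'⊢)
  ; assoc = λ γ⊢ δ⊢ σ⊢ → MP.≡⇒≣ₛ (MP.⊢ₛ-∘ₛ (MP.⊢ₛ-∘ₛ γ⊢ δ⊢) σ⊢)
      (MP.∘ₛ-assoc (MP.ScopedSub-lenS (MP.⊢ₛ⇒lenS δ⊢) (MP.⊢ₛ⇒Scoped γ⊢)))
  ; idˡ = λ _ Γ⊢ γ⊢ → MP.≡⇒≣ₛ (MP.⊢ₛ-∘ₛ (MP.⊢ₛ-idS Γ⊢) γ⊢) (MP.∘ₛ-identityˡ _ _ (MP.⊢ₛ⇒lenS γ⊢))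
  ; idʳ = λ Δ⊢ _ γ⊢ → MP.≡⇒≣ₛ (MP.⊢ₛ-∘ₛ γ⊢ (MP.⊢ₛ-idS Δ⊢)) (MP.∘ₛ-identityʳ _ _)
  }

module Desuspension where

  lenS-DS : ∀ σ → M.lenS (DS σ) ≡ C.lenS σ
  lenS-DS C.⟨⟩ = refl
  lenS-DS (σ C.,, t) = cong suc (lenS-DS σ)

  D-lookupS : ∀ σ i → Dt (C.lookupS σ i) ≡ M.lookupS (DS σ) i
  D-lookupS C.⟨⟩ i = refl
  D-lookupS (σ C.,, t) i rewrite lenS-DS σ with i ≡ᵇ C.lenS σ
  ... | true = refl
  ... | false = D-lookupS σ i

  D-[]T : ∀ A σ → DT (A C.[ σ ]T) ≡ DT A M.[ DS σ ]T
  D-[]t : ∀ t σ → Dt (t C.[ σ ]t) ≡ Dt t M.[ DS σ ]t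
  D-∘ₛ  : ∀ γ σ → DS (γ C.∘ₛ σ) ≡ DS γ M.∘ₛ DS σ
  D-[]T C.⋆ σ = refl
  D-[]T (C.Hom A t u) σ = cong₃ M.Hom (D-[]T A σ) (D-[]t t σ) (D-[]t u σ)
  D-[]t (C.var i) σ = D-lookupS σ i
  D-[]t (C.op Θ A γ) σ = cong (M.mop Θ A) (D-∘ₛ γ σ)
  D-[]t (C.coh Θ A γ) σ = cong (M.mcoh Θ A) (D-∘ₛ γ σ)
  D-∘ₛ C.⟨⟩ σ = refl
  D-∘ₛ (γ C.,, t) σ = cong₂ M._,,_ (D-∘ₛ γ σ) (D-[]t t σ)

  D-idS : ∀ Γ → DS (C.idS Γ) ≡ M.idS (DC Γ)
  D-idS C.∅ = refl
  D-idS (Γ C.▸ A) = cong₂ M._,,_ (D-idS Γ) (cong M.var (sym (MP.len-DC Γ)))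

  D-∋ : ∀ {Γ i A} → Γ C.∋ i ∶ A → DC Γ M.∋ i ∶ DT A
  D-∋ {Γ C.▸ A} C.here = subst (λ k → (DC Γ M.▸ DT A) M.∋ k ∶ DT A) (MP.len-DC Γ) M.here
  D-∋ (C.there p) = M.there (D-∋ p)

  D-⊢  : ∀ {Γ} → Γ C.⊢ → DC Γ MT.⊢
  D-⊢T : ∀ {Γ A} → Γ C.⊢T A → DC Γ MT.⊢T DT A
  D-⊢t : ∀ {Γ t A} → Γ C.⊢ t ∶ A → DC Γ MT.⊢ Dt t ∶ DT A
  D-⊢ₛ : ∀ {Δ γ Γ} → Δ C.⊢ₛ γ ∶ Γ → DC Δ MT.⊢ₛ DS γ ∶ DC Γ
  D-⊢ C.∅⊢ = MT.∅⊢
  D-⊢ (C.▸⊢ A⊢) = MT.▸⊢ (D-⊢T A⊢)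
  D-⊢T (C.⋆⊢ Γ⊢) = MT.𝟙⊢ (D-⊢ Γ⊢)
  D-⊢T (C.Hom⊢ A⊢ t⊢ u⊢) = MT.Hom⊢ (D-⊢T A⊢) (D-⊢t t⊢) (D-⊢t u⊢)
  D-⊢t (C.var⊢ Γ⊢ p) = MT.var⊢ (D-⊢ Γ⊢) (D-∋ p)
  D-⊢t {Δ} (C.op⊢ {Θ = Θ} {A} {γ} A-op γ⊢) =
    subst (λ T → DC Δ MT.⊢ M.mop Θ A (DS γ) ∶ T) (sym (D-[]T A γ)) (MT.mop⊢ A-op (D-⊢ₛ γ⊢))
  D-⊢t {Δ} (C.coh⊢ {Θ = Θ} {A} {γ} A-coh γ⊢) =
    subst (λ T → DC Δ MT.⊢ M.mcoh Θ A (DS γ) ∶ T) (sym (D-[]T A γ)) (MT.mcoh⊢ A-coh (D-⊢ₛ γ⊢))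
  D-⊢ₛ (C.⟨⟩⊢ Δ⊢) = MT.⟨⟩⊢ (D-⊢ Δ⊢)
  D-⊢ₛ {Δ} (C.,,⊢ {γ = γ} {A} {t} γ⊢ A⊢ t⊢) =
    MT.,,⊢ (D-⊢ₛ γ⊢) (D-⊢T A⊢) (subst (λ T → DC Δ MT.⊢ Dt t ∶ T) (D-[]T A γ) (D-⊢t t⊢))

open Desuspension

D-isSynFunctor : IsSynFunctor CaTT MCaTT DC D₁
D-isSynFunctor = record
  { F₀-wf = D-⊢
  ; F₁-wf = λ _ _ → D-⊢ₛ
  ; F₁-resp = λ { _ _ γ⊢ _ refl → MP.≣ₛ-refl (D-⊢ₛ γ⊢) }
  ; F-id = λ {Γ} Γ⊢ → MP.≡⇒≣ₛ (D-⊢ₛ (CP.⊢ₛ-idS Γ⊢)) (D-idS Γ)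
  ; F-∘ = λ {_} {_} {_} {γ} {δ} _ _ _ γ⊢ δ⊢ → MP.≡⇒≣ₛ (D-⊢ₛ (CP.⊢ₛ-∘ₛ γ⊢ δ⊢)) (D-∘ₛ γ δ)
  }

module ReducedSuspension where

  isUnit⇒≡𝟙 : ∀ {A} → isUnit A ≡ true → A ≡ M.𝟙
  isUnit⇒≡𝟙 {M.𝟙} _ = refl

  ≣T⇒isUnit≡ : ∀ {Γ A B} → Γ MT.⊢ A ≣T B → isUnit A ≡ isUnit B
  ≣T⇒isUnit≡ (MT.𝟙≣ _) = refl
  ≣T⇒isUnit≡ (MT.Hom≣ _ _ _) = refl
  ≣T⇒isUnit≡ (MT.symT A≣B) = sym (≣T⇒isUnit≡ A≣B)
  ≣T⇒isUnit≡ (MT.transT A≣B B≣C) = trans (≣T⇒isUnit≡ A≣B) (≣T⇒isUnit≡ B≣C)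

  Σv-pop : ∀ Γ B i → i < M.len Γ → Σv (Γ M.▸ B) i ≡ Σv Γ i
  Σv-pop Γ B i i<Γ rewrite <⇒≡ᵇ-false i<Γ = refl

  Σv-top : ∀ Γ B → Σv (Γ M.▸ B) (M.len Γ) ≡ (if isUnit B then C.var 0 else C.var (suc (nu Γ)))
  Σv-top Γ B rewrite ≡ᵇ-refl (M.len Γ) = refl

  Σv-top-DC : ∀ Θ B → Σv (DC Θ M.▸ B) (C.len Θ) ≡ (if isUnit B then C.var 0 else C.var (suc (nu (DC Θ))))
  Σv-top-DC Θ B rewrite sym (MP.len-DC Θ) = Σv-top (DC Θ) B

  Σv-𝟙 : ∀ {Γ i} → Γ M.∋ i ∶ M.𝟙 → Σv Γ i ≡ C.var 0
  Σv-𝟙 {Γ M.▸ M.𝟙} M.here = Σv-top Γ M.𝟙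
  Σv-𝟙 {Γ M.▸ B} {i} (M.there p) = trans (Σv-pop Γ B i (MP.∋⇒<len p)) (Σv-𝟙 p)

  Σv-Scoped : ∀ Γ i → CP.ScopedTm (suc (nu Γ)) (Σv Γ i)
  Σv-Scoped M.∅ i = CP.varˢ (s≤s z≤n)
  Σv-Scoped (Γ M.▸ M.𝟙) i with i ≡ᵇ M.len Γ
  ... | true = CP.varˢ (s≤s z≤n)
  ... | false = Σv-Scoped Γ i
  Σv-Scoped (Γ M.▸ M.Hom _ _ _) i with i ≡ᵇ M.len Γ
  ... | true = CP.varˢ ≤-refl
  ... | false = CP.ScopedTm-mono (n≤1+n _) (Σv-Scoped Γ i)

  len-ΣrC : ∀ Γ → C.len (ΣrC Γ) ≡ suc (nu Γ)
  len-ΣrC M.∅ = refl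
  len-ΣrC (Γ M.▸ M.𝟙) = len-ΣrC Γ
  len-ΣrC (Γ M.▸ M.Hom _ _ _) = cong suc (len-ΣrC Γ)

  lenS-ΣrS : ∀ Δ Γ γ → M.lenS γ ≡ M.len Γ → C.lenS (ΣrS Δ Γ γ) ≡ suc (nu Γ)
  lenS-ΣrS Δ M.∅ γ _ = refl
  lenS-ΣrS Δ (Γ M.▸ M.𝟙) (γ M.,, t) eq = lenS-ΣrS Δ Γ γ (suc-injective eq)
  lenS-ΣrS Δ (Γ M.▸ M.Hom _ _ _) (γ M.,, t) eq = cong suc (lenS-ΣrS Δ Γ γ (suc-injective eq))

  ΣrS-• : ∀ Δ Γ γ → M.lenS γ ≡ M.len Γ → C.lookupS (ΣrS Δ Γ γ) 0 ≡ C.var 0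
  ΣrS-• Δ M.∅ γ _ = refl
  ΣrS-• Δ (Γ M.▸ M.𝟙) (γ M.,, t) eq = ΣrS-• Δ Γ γ (suc-injective eq)
  ΣrS-• Δ (Γ M.▸ M.Hom _ _ _) (γ M.,, t) eq
    rewrite lenS-ΣrS Δ Γ γ (suc-injective eq) = ΣrS-• Δ Γ γ (suc-injective eq)

  ΣrT-weaken : ∀ {Γ B A} → MP.ScopedTy (M.len Γ) A → ΣrT (Γ M.▸ B) A ≡ ΣrT Γ A
  Σrt-weaken : ∀ {Γ B t} → MP.ScopedTm (M.len Γ) t → Σrt (Γ M.▸ B) t ≡ Σrt Γ t
  ΣrS-weaken : ∀ {Γ B Θ γ} → MP.ScopedSub (M.len Γ) γ → ΣrS (Γ M.▸ B) Θ γ ≡ ΣrS Γ Θ γ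
  ΣrT-weaken MP.𝟙ˢ = refl
  ΣrT-weaken (MP.Homˢ a t u) = cong₃ C.Hom (ΣrT-weaken a) (Σrt-weaken t) (Σrt-weaken u)
  Σrt-weaken {Γ} {B} (MP.varˢ {i} i<Γ) = Σv-pop Γ B i i<Γ
  Σrt-weaken MP.ttˢ = refl
  Σrt-weaken {Γ} {B} {M.mop Θ A γ} (MP.mopˢ γˢ) =
    cong (λ x → C.op Θ A (bullet Θ C.∘ₛ x)) (ΣrS-weaken {Γ} {B} {DC Θ} γˢ)
  Σrt-weaken {Γ} {B} {M.mcoh Θ A γ} (MP.mcohˢ γˢ) =
    cong (λ x → C.coh Θ A (bullet Θ C.∘ₛ x)) (ΣrS-weaken {Γ} {B} {DC Θ} γˢ)
  ΣrS-weaken {Θ = M.∅} _ = refl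
  ΣrS-weaken {Θ = Θ M.▸ A} MP.⟨⟩ˢ = refl
  ΣrS-weaken {Γ} {B} {Θ M.▸ M.𝟙} (MP.,,ˢ γˢ _) = ΣrS-weaken {Γ} {B} {Θ} γˢ
  ΣrS-weaken {Γ} {B} {Θ M.▸ M.Hom _ _ _} (MP.,,ˢ γˢ tˢ) = cong₂ C._,,_ (ΣrS-weaken {Γ} {B} {Θ} γˢ) (Σrt-weaken tˢ)

  -- Σr sends every term of type 𝟙 to •, not only (); this is why Σr respects the η-rule of 𝟙.
  Σrt-unit : ∀ {Γ t A} → Γ MT.⊢ t ∶ A → isUnit A ≡ true → Σrt Γ t ≡ C.var 0
  Σrt-unit (MT.var⊢ _ p) A-unit with isUnit⇒≡𝟙 A-unit
  ... | refl = Σv-𝟙 p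
  Σrt-unit (MT.tt⊢ _) _ = refl
  Σrt-unit (MT.mop⊢ (C.isOp _ _ _ _ _) _) ()
  Σrt-unit (MT.mcoh⊢ (C.isCoh _ _ _ _) _) ()
  Σrt-unit (MT.conv⊢ t⊢ A≣B) B-unit = Σrt-unit t⊢ (trans (≣T⇒isUnit≡ A≣B) B-unit)

  ΣrT-resp-≣T : ∀ {Γ A B} → Γ MT.⊢ A ≣T B → ΣrT Γ A ≡ ΣrT Γ B
  Σrt-resp-≣  : ∀ {Γ t u A} → Γ MT.⊢ t ≣ u ∶ A → Σrt Γ t ≡ Σrt Γ u
  ΣrS-resp-≣ₛ : ∀ {Δ γ δ Γ} → Δ MT.⊢ₛ γ ≣ δ ∶ Γ → ΣrS Δ Γ γ ≡ ΣrS Δ Γ δ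
  ΣrT-resp-≣T (MT.𝟙≣ _) = refl
  ΣrT-resp-≣T (MT.Hom≣ A≣ t≣ u≣) = cong₃ C.Hom (ΣrT-resp-≣T A≣) (Σrt-resp-≣ t≣) (Σrt-resp-≣ u≣)
  ΣrT-resp-≣T (MT.symT A≣B) = sym (ΣrT-resp-≣T A≣B)
  ΣrT-resp-≣T (MT.transT A≣B B≣C) = trans (ΣrT-resp-≣T A≣B) (ΣrT-resp-≣T B≣C)
  Σrt-resp-≣ (MT.refl≣ _) = refl
  Σrt-resp-≣ (MT.sym≣ t≣u) = sym (Σrt-resp-≣ t≣u)
  Σrt-resp-≣ (MT.trans≣ t≣u u≣v) = trans (Σrt-resp-≣ t≣u) (Σrt-resp-≣ u≣v)
  Σrt-resp-≣ (MT.conv≣ t≣u _) = Σrt-resp-≣ t≣u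
  Σrt-resp-≣ (MT.η𝟙 t⊢) = Σrt-unit t⊢ refl
  Σrt-resp-≣ (MT.mop≣ {Θ = Θ} {A} _ γ≣δ) = cong (λ x → C.op Θ A (bullet Θ C.∘ₛ x)) (ΣrS-resp-≣ₛ γ≣δ)
  Σrt-resp-≣ (MT.mcoh≣ {Θ = Θ} {A} _ γ≣δ) = cong (λ x → C.coh Θ A (bullet Θ C.∘ₛ x)) (ΣrS-resp-≣ₛ γ≣δ)
  ΣrS-resp-≣ₛ (MT.⟨⟩≣ _) = refl
  ΣrS-resp-≣ₛ (MT.,,≣ {A = M.𝟙} γ≣δ _ _) = ΣrS-resp-≣ₛ γ≣δ
  ΣrS-resp-≣ₛ (MT.,,≣ {A = M.Hom _ _ _} γ≣δ _ t≣u) = cong₂ C._,,_ (ΣrS-resp-≣ₛ γ≣δ) (Σrt-resp-≣ t≣u)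

  Σrt-lookupS : ∀ {Δ σ Γ i A} → Δ MT.⊢ₛ σ ∶ Γ → Γ M.∋ i ∶ A →
                Σrt Δ (M.lookupS σ i) ≡ Σv Γ i C.[ ΣrS Δ Γ σ ]t
  Σrt-lookupS {Δ} (MT.,,⊢ {Γ = Γ} {γ} {M.𝟙} {t} γ⊢ _ t⊢) M.here = begin
    Σrt Δ (M.lookupS (γ M.,, t) (M.len Γ)) ≡⟨ cong (Σrt Δ) (MP.lookupS-top γ t (MP.⊢ₛ⇒lenS γ⊢)) ⟩
    Σrt Δ t                                ≡⟨ Σrt-unit t⊢ refl ⟩
    C.var 0                                ≡⟨ sym (ΣrS-• Δ Γ γ (MP.⊢ₛ⇒lenS γ⊢)) ⟩
    C.lookupS (ΣrS Δ Γ γ) 0                ≡⟨ cong (C._[ ΣrS Δ Γ γ ]t) (sym (Σv-top Γ M.𝟙)) ⟩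
    Σv (Γ M.▸ M.𝟙) (M.len Γ) C.[ ΣrS Δ Γ γ ]t ∎
    where open ≡-Reasoning
  Σrt-lookupS {Δ} (MT.,,⊢ {Γ = Γ} {γ} {A@(M.Hom _ _ _)} {t} γ⊢ _ _) M.here = begin
    Σrt Δ (M.lookupS (γ M.,, t) (M.len Γ))         ≡⟨ cong (Σrt Δ) (MP.lookupS-top γ t (MP.⊢ₛ⇒lenS γ⊢)) ⟩
    Σrt Δ t                                        ≡⟨ sym (CP.lookupS-top (ΣrS Δ Γ γ) _ (lenS-ΣrS Δ Γ γ (MP.⊢ₛ⇒lenS γ⊢))) ⟩
    C.var (suc (nu Γ)) C.[ ΣrS Δ Γ γ C.,, Σrt Δ t ]t ≡⟨ cong (C._[ ΣrS Δ Γ γ C.,, Σrt Δ t ]t) (sym (Σv-top Γ A)) ⟩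
    Σv (Γ M.▸ A) (M.len Γ) C.[ ΣrS Δ Γ γ C.,, Σrt Δ t ]t ∎
    where open ≡-Reasoning
  Σrt-lookupS {Δ} (MT.,,⊢ {Γ = Γ} {γ} {M.𝟙} {t} γ⊢ _ _) (M.there {i = i} p) =
    trans (cong (Σrt Δ) (MP.lookupS-pop γ t (subst (i <_) (sym (MP.⊢ₛ⇒lenS γ⊢)) (MP.∋⇒<len p))))
      (trans (Σrt-lookupS γ⊢ p) (cong (C._[ ΣrS Δ Γ γ ]t) (sym (Σv-pop Γ M.𝟙 i (MP.∋⇒<len p)))))
  Σrt-lookupS {Δ} (MT.,,⊢ {Γ = Γ} {γ} {A@(M.Hom _ _ _)} {t} γ⊢ _ _) (M.there {i = i} p) = begin
    Σrt Δ (M.lookupS (γ M.,, t) i)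
      ≡⟨ cong (Σrt Δ) (MP.lookupS-pop γ t (subst (i <_) (sym (MP.⊢ₛ⇒lenS γ⊢)) (MP.∋⇒<len p))) ⟩
    Σrt Δ (M.lookupS γ i)
      ≡⟨ Σrt-lookupS γ⊢ p ⟩
    Σv Γ i C.[ ΣrS Δ Γ γ ]t
      ≡⟨ sym (CP.[]t-extend (CP.ScopedTm-lenS (lenS-ΣrS Δ Γ γ (MP.⊢ₛ⇒lenS γ⊢)) (Σv-Scoped Γ i))) ⟩
    Σv Γ i C.[ ΣrS Δ Γ γ C.,, Σrt Δ t ]t
      ≡⟨ cong (C._[ ΣrS Δ Γ γ C.,, Σrt Δ t ]t) (sym (Σv-pop Γ A i (MP.∋⇒<len p))) ⟩
    Σv (Γ M.▸ A) i C.[ ΣrS Δ Γ γ C.,, Σrt Δ t ]t ∎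
    where open ≡-Reasoning

  nu-DC-▸ : ∀ Θ A → nu (DC Θ) ≤ nu (DC (Θ C.▸ A))
  nu-DC-▸ Θ C.⋆ = ≤-refl
  nu-DC-▸ Θ (C.Hom _ _ _) = n≤1+n _

  bullet-Scoped : ∀ Θ → CP.ScopedSub (suc (nu (DC Θ))) (bullet Θ)
  bullet-Scoped C.∅ = CP.⟨⟩ˢ
  bullet-Scoped (Θ C.▸ A) =
    CP.,,ˢ (CP.ScopedSub-mono (s≤s (nu-DC-▸ Θ A)) (bullet-Scoped Θ)) (Σv-Scoped (DC (Θ C.▸ A)) (C.len Θ))

  lenS-bullet : ∀ Θ → C.lenS (bullet Θ) ≡ C.len Θ
  lenS-bullet C.∅ = refl
  lenS-bullet (Θ C.▸ A) = cong suc (lenS-bullet Θ)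

  bullet-∘ₛ-assoc : ∀ {Γ Θ γ σ} → M.lenS γ ≡ M.len (DC Θ) →
                    (bullet Θ C.∘ₛ ΣrS Γ (DC Θ) γ) C.∘ₛ σ ≡ bullet Θ C.∘ₛ (ΣrS Γ (DC Θ) γ C.∘ₛ σ)
  bullet-∘ₛ-assoc {Γ = Γ} {Θ} {γ} eq =
    CP.∘ₛ-assoc (CP.ScopedSub-lenS (lenS-ΣrS Γ (DC Θ) γ eq) (bullet-Scoped Θ))

  ΣrT-[] : ∀ {Δ σ Γ A} → Δ MT.⊢ₛ σ ∶ Γ → Γ MT.⊢T A → ΣrT Δ (A M.[ σ ]T) ≡ ΣrT Γ A C.[ ΣrS Δ Γ σ ]T
  Σrt-[] : ∀ {Δ σ Γ t A} → Δ MT.⊢ₛ σ ∶ Γ → Γ MT.⊢ t ∶ A → Σrt Δ (t M.[ σ ]t) ≡ Σrt Γ t C.[ ΣrS Δ Γ σ ]t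
  ΣrS-∘ₛ : ∀ {Δ σ Γ γ Θ} → Δ MT.⊢ₛ σ ∶ Γ → Γ MT.⊢ₛ γ ∶ Θ → ΣrS Δ Θ (γ M.∘ₛ σ) ≡ ΣrS Γ Θ γ C.∘ₛ ΣrS Δ Γ σ
  ΣrT-[] σ⊢ (MT.𝟙⊢ _) = refl
  ΣrT-[] σ⊢ (MT.Hom⊢ A⊢ t⊢ u⊢) = cong₃ C.Hom (ΣrT-[] σ⊢ A⊢) (Σrt-[] σ⊢ t⊢) (Σrt-[] σ⊢ u⊢)
  Σrt-[] σ⊢ (MT.var⊢ _ p) = Σrt-lookupS σ⊢ p
  Σrt-[] {Δ} {σ} {Γ} σ⊢ (MT.tt⊢ _) = sym (ΣrS-• Δ Γ σ (MP.⊢ₛ⇒lenS σ⊢))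
  Σrt-[] σ⊢ (MT.mop⊢ {Θ = Θ} {A} _ γ⊢) =
    cong (C.op Θ A) (trans (cong (bullet Θ C.∘ₛ_) (ΣrS-∘ₛ σ⊢ γ⊢)) (sym (bullet-∘ₛ-assoc (MP.⊢ₛ⇒lenS γ⊢))))
  Σrt-[] σ⊢ (MT.mcoh⊢ {Θ = Θ} {A} _ γ⊢) =
    cong (C.coh Θ A) (trans (cong (bullet Θ C.∘ₛ_) (ΣrS-∘ₛ σ⊢ γ⊢)) (sym (bullet-∘ₛ-assoc (MP.⊢ₛ⇒lenS γ⊢))))
  Σrt-[] σ⊢ (MT.conv⊢ t⊢ _) = Σrt-[] σ⊢ t⊢
  ΣrS-∘ₛ {Δ} {σ} {Γ} σ⊢ (MT.⟨⟩⊢ _) = cong (C.⟨⟩ C.,,_) (sym (ΣrS-• Δ Γ σ (MP.⊢ₛ⇒lenS σ⊢)))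
  ΣrS-∘ₛ σ⊢ (MT.,,⊢ {A = M.𝟙} γ⊢ _ _) = ΣrS-∘ₛ σ⊢ γ⊢
  ΣrS-∘ₛ σ⊢ (MT.,,⊢ {A = M.Hom _ _ _} γ⊢ _ t⊢) = cong₂ C._,,_ (ΣrS-∘ₛ σ⊢ γ⊢) (Σrt-[] σ⊢ t⊢)

  Σv-DC≡lookupS-bullet : ∀ Θ i → i < C.len Θ → Σv (DC Θ) i ≡ C.lookupS (bullet Θ) i
  Σv-DC≡lookupS-bullet (Θ C.▸ A) i i<Θ with m<1+n⇒m<n∨m≡n i<Θ
  ... | inj₂ refl = sym (CP.lookupS-top (bullet Θ) _ (lenS-bullet Θ))
  ... | inj₁ i<Θ' = begin
    Σv (DC Θ M.▸ DT A) i              ≡⟨ Σv-pop (DC Θ) (DT A) i (subst (i <_) (sym (MP.len-DC Θ)) i<Θ') ⟩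
    Σv (DC Θ) i                       ≡⟨ Σv-DC≡lookupS-bullet Θ i i<Θ' ⟩
    C.lookupS (bullet Θ) i            ≡⟨ sym (CP.lookupS-pop (bullet Θ) _ (subst (i <_) (sym (lenS-bullet Θ)) i<Θ')) ⟩
    C.lookupS (bullet (Θ C.▸ A)) i    ∎
    where open ≡-Reasoning

  lenS-DS-⊢ₛ : ∀ {Θ γ Θ'} → Θ C.⊢ₛ γ ∶ Θ' → M.lenS (DS γ) ≡ M.len (DC Θ')
  lenS-DS-⊢ₛ {Θ' = Θ'} γ⊢ = trans (lenS-DS _) (trans (CP.⊢ₛ⇒lenS γ⊢) (sym (MP.len-DC Θ')))

  ΣrDT≡[bullet] : ∀ {Θ A} → Θ C.⊢T A → ΣrT (DC Θ) (DT A) ≡ A C.[ bullet Θ ]T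
  ΣrDt≡[bullet] : ∀ {Θ t A} → Θ C.⊢ t ∶ A → Σrt (DC Θ) (Dt t) ≡ t C.[ bullet Θ ]t
  bullet-natural : ∀ {Θ γ Θ'} → Θ C.⊢ₛ γ ∶ Θ' → bullet Θ' C.∘ₛ ΣrS (DC Θ) (DC Θ') (DS γ) ≡ γ C.∘ₛ bullet Θ
  ΣrDT≡[bullet] (C.⋆⊢ _) = refl
  ΣrDT≡[bullet] (C.Hom⊢ A⊢ t⊢ u⊢) = cong₃ C.Hom (ΣrDT≡[bullet] A⊢) (ΣrDt≡[bullet] t⊢) (ΣrDt≡[bullet] u⊢)
  ΣrDt≡[bullet] {Θ} (C.var⊢ _ p) = Σv-DC≡lookupS-bullet Θ _ (CP.∋⇒<len p)
  ΣrDt≡[bullet] (C.op⊢ {Θ = Θ} {A} _ γ⊢) = cong (C.op Θ A) (bullet-natural γ⊢)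
  ΣrDt≡[bullet] (C.coh⊢ {Θ = Θ} {A} _ γ⊢) = cong (C.coh Θ A) (bullet-natural γ⊢)
  bullet-natural (C.⟨⟩⊢ _) = refl
  bullet-natural {Θ} (C.,,⊢ {Γ = Θ'} {γ} {C.⋆} {t} γ⊢ _ t⊢) = cong₂ C._,,_ (bullet-natural γ⊢) (begin
    Σv (DC Θ' M.▸ M.𝟙) (C.len Θ') C.[ Σγ ]t ≡⟨ cong (C._[ Σγ ]t) (Σv-top-DC Θ' M.𝟙) ⟩
    C.lookupS Σγ 0                         ≡⟨ ΣrS-• (DC Θ) (DC Θ') (DS γ) (lenS-DS-⊢ₛ γ⊢) ⟩
    C.var 0                                ≡⟨ sym (Σrt-unit (D-⊢t t⊢) refl) ⟩
    Σrt (DC Θ) (Dt t)                      ≡⟨ ΣrDt≡[bullet] t⊢ ⟩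
    t C.[ bullet Θ ]t                      ∎)
    where
    open ≡-Reasoning
    Σγ = ΣrS (DC Θ) (DC Θ') (DS γ)
  bullet-natural {Θ} (C.,,⊢ {Γ = Θ'} {γ} {A@(C.Hom _ _ _)} {t} γ⊢ _ t⊢) = cong₂ C._,,_
    (trans (CP.∘ₛ-extend (CP.ScopedSub-lenS (lenS-ΣrS (DC Θ) (DC Θ') (DS γ) (lenS-DS-⊢ₛ γ⊢)) (bullet-Scoped Θ')))
           (bullet-natural γ⊢))
    (begin
      Σv (DC Θ' M.▸ DT A) (C.len Θ') C.[ Σγ C.,, Σrt (DC Θ) (Dt t) ]t
        ≡⟨ cong (C._[ Σγ C.,, Σrt (DC Θ) (Dt t) ]t) (Σv-top-DC Θ' (DT A)) ⟩
      C.lookupS (Σγ C.,, Σrt (DC Θ) (Dt t)) (suc (nu (DC Θ')))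
        ≡⟨ CP.lookupS-top Σγ _ (lenS-ΣrS (DC Θ) (DC Θ') (DS γ) (lenS-DS-⊢ₛ γ⊢)) ⟩
      Σrt (DC Θ) (Dt t)
        ≡⟨ ΣrDt≡[bullet] t⊢ ⟩
      t C.[ bullet Θ ]t ∎)
    where
    open ≡-Reasoning
    Σγ = ΣrS (DC Θ) (DC Θ') (DS γ)

  ΣrC-∋• : ∀ Γ → ΣrC Γ C.∋ 0 ∶ C.⋆
  ΣrC-∋• M.∅ = C.here
  ΣrC-∋• (Γ M.▸ M.𝟙) = ΣrC-∋• Γ
  ΣrC-∋• (Γ M.▸ M.Hom _ _ _) = C.there (ΣrC-∋• Γ)

  -- Both components are proved together: extending Θ by a Hom-type needs bullet Θ to type its suspension.
  bullet-typing : ∀ {Θ} → Θ C.⊢ → (ΣrC (DC Θ) C.⊢) × (ΣrC (DC Θ) C.⊢ₛ bullet Θ ∶ Θ)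
  bullet-typing C.∅⊢ = C.▸⊢ (C.⋆⊢ C.∅⊢) , C.⟨⟩⊢ (C.▸⊢ (C.⋆⊢ C.∅⊢))
  bullet-typing (C.▸⊢ {Θ} {C.⋆} A⊢) =
    ΣDΘ⊢ , C.,,⊢ bullet⊢ A⊢ (subst (λ x → ΣrC (DC Θ) C.⊢ x ∶ C.⋆) (sym (Σv-top-DC Θ M.𝟙)) (C.var⊢ ΣDΘ⊢ (ΣrC-∋• (DC Θ))))
    where ΣDΘ⊢ = proj₁ (bullet-typing (CP.⊢T⇒⊢ A⊢))
          bullet⊢ = proj₂ (bullet-typing (CP.⊢T⇒⊢ A⊢))
  bullet-typing (C.▸⊢ {Θ} {A@(C.Hom _ _ _)} A⊢) = ΣDΘ▸⊢ , C.,,⊢ (CP.⊢ₛ-weaken ΣDΘ▸⊢ bullet⊢) A⊢ top⊢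
    where
    bullet⊢ = proj₂ (bullet-typing (CP.⊢T⇒⊢ A⊢))
    ΣDA = ΣrT (DC Θ) (DT A)
    ΣDΘ▸⊢ : (ΣrC (DC Θ) C.▸ ΣDA) C.⊢
    ΣDΘ▸⊢ = C.▸⊢ (subst (ΣrC (DC Θ) C.⊢T_) (sym (ΣrDT≡[bullet] A⊢)) (CP.⊢T-[] bullet⊢ A⊢))
    top⊢ : (ΣrC (DC Θ) C.▸ ΣDA) C.⊢ Σv (DC (Θ C.▸ A)) (C.len Θ) ∶ (A C.[ bullet Θ ]T)
    top⊢ = subst₂ (λ x T → (ΣrC (DC Θ) C.▸ ΣDA) C.⊢ x ∶ T)
             (trans (cong C.var (len-ΣrC (DC Θ))) (sym (Σv-top-DC Θ (DT A)))) (ΣrDT≡[bullet] A⊢)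
             (C.var⊢ ΣDΘ▸⊢ C.here)

  bullet-⊢ₛ : ∀ {Θ} → Θ C.⊢ → ΣrC (DC Θ) C.⊢ₛ bullet Θ ∶ Θ
  bullet-⊢ₛ Θ⊢ = proj₂ (bullet-typing Θ⊢)

  Σr-∋ : ∀ {Γ i A} → Γ MT.⊢ → ΣrC Γ C.⊢ → Γ M.∋ i ∶ A → ΣrC Γ C.⊢ Σv Γ i ∶ ΣrT Γ A
  Σr-∋ (MT.▸⊢ {Γ} {M.𝟙} _) ΣΓ⊢ M.here =
    subst (λ x → ΣrC Γ C.⊢ x ∶ C.⋆) (sym (Σv-top Γ M.𝟙)) (C.var⊢ ΣΓ⊢ (ΣrC-∋• Γ))
  Σr-∋ (MT.▸⊢ {Γ} {B@(M.Hom _ _ _)} B⊢) ΣΓ▸⊢ M.here =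
    subst₂ (λ x T → ΣrC (Γ M.▸ B) C.⊢ x ∶ T)
      (trans (cong C.var (len-ΣrC Γ)) (sym (Σv-top Γ B))) (sym (ΣrT-weaken (MP.⊢T⇒Scoped B⊢)))
      (C.var⊢ ΣΓ▸⊢ C.here)
  Σr-∋ (MT.▸⊢ {Γ} {M.𝟙} B⊢) ΣΓ⊢ (M.there {i = i} p) =
    subst₂ (λ x T → ΣrC Γ C.⊢ x ∶ T)
      (sym (Σv-pop Γ M.𝟙 i (MP.∋⇒<len p))) (sym (ΣrT-weaken (MP.∋⇒Scoped (MP.⊢T⇒⊢ B⊢) p)))
      (Σr-∋ (MP.⊢T⇒⊢ B⊢) ΣΓ⊢ p)
  Σr-∋ (MT.▸⊢ {Γ} {B@(M.Hom _ _ _)} B⊢) ΣΓ▸⊢@(C.▸⊢ ΣB⊢) (M.there {i = i} p) =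
    subst₂ (λ x T → ΣrC (Γ M.▸ B) C.⊢ x ∶ T)
      (sym (Σv-pop Γ B i (MP.∋⇒<len p))) (sym (ΣrT-weaken (MP.∋⇒Scoped (MP.⊢T⇒⊢ B⊢) p)))
      (CP.⊢t-weaken ΣΓ▸⊢ (Σr-∋ (MP.⊢T⇒⊢ B⊢) (CP.⊢T⇒⊢ ΣB⊢) p))

  ΣrT-D[] : ∀ {Δ Θ A γ} → Θ C.⊢T A → Δ MT.⊢ₛ γ ∶ DC Θ →
            ΣrT Δ (DT A M.[ γ ]T) ≡ A C.[ bullet Θ C.∘ₛ ΣrS Δ (DC Θ) γ ]T
  ΣrT-D[] {Δ} {Θ} {A} {γ} A⊢ γ⊢ = begin
    ΣrT Δ (DT A M.[ γ ]T)                       ≡⟨ ΣrT-[] γ⊢ (D-⊢T A⊢) ⟩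
    ΣrT (DC Θ) (DT A) C.[ ΣrS Δ (DC Θ) γ ]T     ≡⟨ cong (C._[ ΣrS Δ (DC Θ) γ ]T) (ΣrDT≡[bullet] A⊢) ⟩
    A C.[ bullet Θ ]T C.[ ΣrS Δ (DC Θ) γ ]T     ≡⟨ CP.[]T-∘ₛ (CP.ScopedTy-lenS (lenS-bullet Θ) (CP.⊢T⇒Scoped A⊢)) ⟩
    A C.[ bullet Θ C.∘ₛ ΣrS Δ (DC Θ) γ ]T       ∎
    where open ≡-Reasoning

  Σr-⊢  : ∀ {Γ} → Γ MT.⊢ → ΣrC Γ C.⊢
  Σr-⊢T : ∀ {Γ A} → Γ MT.⊢T A → ΣrC Γ C.⊢T ΣrT Γ A
  Σr-⊢t : ∀ {Γ t A} → Γ MT.⊢ t ∶ A → ΣrC Γ C.⊢ Σrt Γ t ∶ ΣrT Γ A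
  Σr-⊢ₛ : ∀ {Δ γ Γ} → Δ MT.⊢ₛ γ ∶ Γ → ΣrC Δ C.⊢ₛ ΣrS Δ Γ γ ∶ ΣrC Γ
  Σr-⊢ MT.∅⊢ = C.▸⊢ (C.⋆⊢ C.∅⊢)
  Σr-⊢ (MT.▸⊢ (MT.𝟙⊢ Γ⊢)) = Σr-⊢ Γ⊢
  Σr-⊢ (MT.▸⊢ A⊢@(MT.Hom⊢ _ _ _)) = C.▸⊢ (Σr-⊢T A⊢)
  Σr-⊢T (MT.𝟙⊢ Γ⊢) = C.⋆⊢ (Σr-⊢ Γ⊢)
  Σr-⊢T (MT.Hom⊢ A⊢ t⊢ u⊢) = C.Hom⊢ (Σr-⊢T A⊢) (Σr-⊢t t⊢) (Σr-⊢t u⊢)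
  Σr-⊢t (MT.var⊢ Γ⊢ p) = Σr-∋ Γ⊢ (Σr-⊢ Γ⊢) p
  Σr-⊢t {Γ} (MT.tt⊢ Γ⊢) = C.var⊢ (Σr-⊢ Γ⊢) (ΣrC-∋• Γ)
  Σr-⊢t {Δ} (MT.mop⊢ {Θ = Θ} {A} {γ} A-op γ⊢) =
    subst (λ T → ΣrC Δ C.⊢ C.op Θ A (bullet Θ C.∘ₛ ΣrS Δ (DC Θ) γ) ∶ T) (sym (ΣrT-D[] A⊢ γ⊢))
      (C.op⊢ A-op (CP.⊢ₛ-∘ₛ (bullet-⊢ₛ (CP.⊢T⇒⊢ A⊢)) (Σr-⊢ₛ γ⊢)))
    where A⊢ = CP.IsOpTy⇒⊢T A-op
  Σr-⊢t {Δ} (MT.mcoh⊢ {Θ = Θ} {A} {γ} A-coh γ⊢) =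
    subst (λ T → ΣrC Δ C.⊢ C.coh Θ A (bullet Θ C.∘ₛ ΣrS Δ (DC Θ) γ) ∶ T) (sym (ΣrT-D[] A⊢ γ⊢))
      (C.coh⊢ A-coh (CP.⊢ₛ-∘ₛ (bullet-⊢ₛ (CP.⊢T⇒⊢ A⊢)) (Σr-⊢ₛ γ⊢)))
    where A⊢ = CP.IsCohTy⇒⊢T A-coh
  Σr-⊢t {Γ} {t} (MT.conv⊢ t⊢ A≣B) = subst (λ T → ΣrC Γ C.⊢ Σrt Γ t ∶ T) (ΣrT-resp-≣T A≣B) (Σr-⊢t t⊢)
  Σr-⊢ₛ {Δ} (MT.⟨⟩⊢ Δ⊢) = C.,,⊢ (C.⟨⟩⊢ (Σr-⊢ Δ⊢)) (C.⋆⊢ C.∅⊢) (C.var⊢ (Σr-⊢ Δ⊢) (ΣrC-∋• Δ))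
  Σr-⊢ₛ (MT.,,⊢ {A = M.𝟙} γ⊢ _ _) = Σr-⊢ₛ γ⊢
  Σr-⊢ₛ {Δ} (MT.,,⊢ {A = M.Hom _ _ _} {t} γ⊢ A⊢ t⊢) =
    C.,,⊢ (Σr-⊢ₛ γ⊢) (Σr-⊢T A⊢) (subst (λ T → ΣrC Δ C.⊢ Σrt Δ t ∶ T) (ΣrT-[] γ⊢ A⊢) (Σr-⊢t t⊢))

  ΣrS-idS : ∀ Γ → ΣrS Γ Γ (M.idS Γ) ≡ C.idS (ΣrC Γ)
  ΣrS-idS M.∅ = refl
  ΣrS-idS (Γ M.▸ M.𝟙) = trans (ΣrS-weaken {Γ} {M.𝟙} {Γ} (MP.ScopedSub-idS Γ)) (ΣrS-idS Γ)
  ΣrS-idS (Γ M.▸ B@(M.Hom _ _ _)) = cong₂ C._,,_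
    (trans (ΣrS-weaken {Γ} {B} {Γ} (MP.ScopedSub-idS Γ)) (ΣrS-idS Γ))
    (trans (Σv-top Γ B) (cong C.var (sym (len-ΣrC Γ))))

open ReducedSuspension

Σr-isSynFunctor : IsSynFunctor MCaTT CaTT ΣrC ΣrS
Σr-isSynFunctor = record
  { F₀-wf = Σr-⊢
  ; F₁-wf = λ _ _ → Σr-⊢ₛ
  ; F₁-resp = λ _ _ _ _ → ΣrS-resp-≣ₛ
  ; F-id = λ {Γ} _ → ΣrS-idS Γ
  ; F-∘ = λ _ _ _ γ⊢ δ⊢ → ΣrS-∘ₛ δ⊢ γ⊢
  }

module AdjunctionUnit where
  open M using (𝟙; Hom; var; tt; _▸_; _,,_; _∘ₛ_; _[_]t; _[_]T; lookupS; lenS; len)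

  η : M.Ctx → M.Sub
  η M.∅ = M.⟨⟩ ,, tt
  η (Γ ▸ 𝟙) = η Γ
  η (Γ ▸ Hom _ _ _) = η Γ ,, var (len Γ)

  η⁻¹ : M.Ctx → M.Sub
  η⁻¹ M.∅ = M.⟨⟩
  η⁻¹ (Γ ▸ A) = η⁻¹ Γ ,, Dt (Σv (Γ ▸ A) (len Γ))

  var-nf : M.Ty → ℕ → M.Tm
  var-nf A i = if isUnit A then tt else var i

  var≣var-nf : ∀ {Γ i A} → Γ MT.⊢ → Γ M.∋ i ∶ A → Γ MT.⊢ var i ≣ var-nf A i ∶ A
  var≣var-nf {A = 𝟙} Γ⊢ p = MT.η𝟙 (MT.var⊢ Γ⊢ p)
  var≣var-nf {A = Hom _ _ _} Γ⊢ p = MT.refl≣ (MT.var⊢ Γ⊢ p)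

  ≣ₛ-idS-pointwise : ∀ {Δ σ Γ} → Δ MT.⊢ₛ σ ∶ Γ →
                     (∀ {i A} → Γ M.∋ i ∶ A → Δ MT.⊢ var i ≣ lookupS σ i ∶ A) → Δ MT.⊢ₛ σ ≣ M.idS Γ ∶ Γ
  ≣ₛ-idS-pointwise (MT.⟨⟩⊢ Δ⊢) _ = MT.⟨⟩≣ Δ⊢
  ≣ₛ-idS-pointwise {Δ} (MT.,,⊢ {Γ = Γ} {γ} {A} {t} γ⊢ A⊢ _) pw =
    MT.,,≣ γ≣id A⊢ (MT.conv≣ (MT.sym≣ top≣) (MT.symT A[γ]≣A))
    where
    γ≣id : Δ MT.⊢ₛ γ ≣ M.idS Γ ∶ Γ
    γ≣id = ≣ₛ-idS-pointwise γ⊢ (λ {i} {B} p → subst (λ x → Δ MT.⊢ var i ≣ x ∶ B)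
             (MP.lookupS-pop γ t (subst (i <_) (sym (MP.⊢ₛ⇒lenS γ⊢)) (MP.∋⇒<len p))) (pw (M.there p)))
    top≣ : Δ MT.⊢ var (len Γ) ≣ t ∶ A
    top≣ = subst (λ x → Δ MT.⊢ var (len Γ) ≣ x ∶ A) (MP.lookupS-top γ t (MP.⊢ₛ⇒lenS γ⊢)) (pw M.here)
    A[γ]≣A : Δ MT.⊢ (A [ γ ]T) ≣T A
    A[γ]≣A = subst (λ T → Δ MT.⊢ (A [ γ ]T) ≣T T) (MP.[]T-idS Γ A) (MP.[]T-resp-≣ₛ γ⊢ γ≣id A⊢)

  ∘ₛ≣idS-pointwise : ∀ {Γ Θ γ δ} → Γ MT.⊢ → Θ MT.⊢ₛ γ ∶ Γ → Γ MT.⊢ₛ δ ∶ Θ →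
                     (∀ {i A} → Γ M.∋ i ∶ A → lookupS γ i [ δ ]t ≡ var-nf A i) →
                     Γ MT.⊢ₛ γ ∘ₛ δ ≣ M.idS Γ ∶ Γ
  ∘ₛ≣idS-pointwise {Γ} {γ = γ} {δ} Γ⊢ γ⊢ δ⊢ pw = ≣ₛ-idS-pointwise (MP.⊢ₛ-∘ₛ γ⊢ δ⊢) λ {i} {A} p →
    subst (λ x → Γ MT.⊢ var i ≣ x ∶ A)
      (sym (trans (MP.lookupS-∘ₛ γ δ i (subst (i <_) (sym (MP.⊢ₛ⇒lenS γ⊢)) (MP.∋⇒<len p))) (pw p)))
      (var≣var-nf Γ⊢ p)

  lenS-η : ∀ Γ → lenS (η Γ) ≡ suc (nu Γ)
  lenS-η M.∅ = refl
  lenS-η (Γ ▸ 𝟙) = lenS-η Γ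
  lenS-η (Γ ▸ Hom _ _ _) = cong suc (lenS-η Γ)

  lenS-η≡len-DΣr : ∀ Γ → lenS (η Γ) ≡ len (DC (ΣrC Γ))
  lenS-η≡len-DΣr Γ = trans (lenS-η Γ) (trans (sym (len-ΣrC Γ)) (sym (MP.len-DC (ΣrC Γ))))

  lenS-η⁻¹ : ∀ Γ → lenS (η⁻¹ Γ) ≡ len Γ
  lenS-η⁻¹ M.∅ = refl
  lenS-η⁻¹ (Γ ▸ A) = cong suc (lenS-η⁻¹ Γ)

  η-Scoped : ∀ Γ → MP.ScopedSub (len Γ) (η Γ)
  η-Scoped M.∅ = MP.,,ˢ MP.⟨⟩ˢ MP.ttˢ
  η-Scoped (Γ ▸ 𝟙) = MP.ScopedSub-mono (n≤1+n _) (η-Scoped Γ)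
  η-Scoped (Γ ▸ Hom _ _ _) = MP.,,ˢ (MP.ScopedSub-mono (n≤1+n _) (η-Scoped Γ)) (MP.varˢ ≤-refl)

  lookupS-η-• : ∀ Γ → lookupS (η Γ) 0 ≡ tt
  lookupS-η-• M.∅ = refl
  lookupS-η-• (Γ ▸ 𝟙) = lookupS-η-• Γ
  lookupS-η-• (Γ ▸ Hom _ _ _) rewrite lenS-η Γ = lookupS-η-• Γ

  DΣv-[η] : ∀ {Γ i A} → Γ M.∋ i ∶ A → Dt (Σv Γ i) [ η Γ ]t ≡ var-nf A i
  DΣv-[η] {Γ ▸ 𝟙} M.here = trans (cong (λ x → Dt x [ η Γ ]t) (Σv-top Γ 𝟙)) (lookupS-η-• Γ)
  DΣv-[η] {Γ ▸ B@(Hom _ _ _)} M.here =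
    trans (cong (λ x → Dt x [ η (Γ ▸ B) ]t) (Σv-top Γ B)) (MP.lookupS-top (η Γ) (var (len Γ)) (lenS-η Γ))
  DΣv-[η] {Γ ▸ 𝟙} {i} (M.there p) = trans (cong (λ x → Dt x [ η Γ ]t) (Σv-pop Γ 𝟙 i (MP.∋⇒<len p))) (DΣv-[η] p)
  DΣv-[η] {Γ ▸ B@(Hom _ _ _)} {i} (M.there p) = begin
    Dt (Σv (Γ ▸ B) i) [ η Γ ,, var (len Γ) ]t ≡⟨ cong (λ x → Dt x [ η Γ ,, var (len Γ) ]t) (Σv-pop Γ B i (MP.∋⇒<len p)) ⟩
    Dt (Σv Γ i) [ η Γ ,, var (len Γ) ]t       ≡⟨ MP.[]t-extend (MP.ScopedTm-lenS (lenS-η Γ) (MP.ScopedTm-D (Σv-Scoped Γ i))) ⟩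
    Dt (Σv Γ i) [ η Γ ]t                      ≡⟨ DΣv-[η] p ⟩
    var-nf _ i                                ∎
    where open ≡-Reasoning

  lookupS-η⁻¹ : ∀ Γ i → i < len Γ → lookupS (η⁻¹ Γ) i ≡ Dt (Σv Γ i)
  lookupS-η⁻¹ (Γ ▸ A) i i<Γ with m<1+n⇒m<n∨m≡n i<Γ
  ... | inj₂ refl = MP.lookupS-top (η⁻¹ Γ) _ (lenS-η⁻¹ Γ)
  ... | inj₁ i<Γ' = trans (MP.lookupS-pop (η⁻¹ Γ) _ (subst (i <_) (sym (lenS-η⁻¹ Γ)) i<Γ'))
                      (trans (lookupS-η⁻¹ Γ i i<Γ') (cong Dt (sym (Σv-pop Γ A i i<Γ'))))

  lookupS-η-[η⁻¹] : ∀ Γ {j A} → DC (ΣrC Γ) M.∋ j ∶ A → lookupS (η Γ) j [ η⁻¹ Γ ]t ≡ var-nf A j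
  lookupS-η-[η⁻¹] M.∅ M.here = refl
  lookupS-η-[η⁻¹] (Γ ▸ 𝟙) {j} p = trans
    (MP.[]t-extend (MP.ScopedTm-lenS (lenS-η⁻¹ Γ)
      (MP.lookupS-Scoped (η-Scoped Γ) (subst (j <_) (sym (lenS-η≡len-DΣr Γ)) (MP.∋⇒<len p)))))
    (lookupS-η-[η⁻¹] Γ p)
  lookupS-η-[η⁻¹] (Γ ▸ B@(Hom _ _ _)) M.here = begin
    lookupS (η Γ ,, var (len Γ)) (len (DC (ΣrC Γ))) [ η⁻¹ (Γ ▸ B) ]t
      ≡⟨ cong (_[ η⁻¹ (Γ ▸ B) ]t) (MP.lookupS-top (η Γ) _ (lenS-η≡len-DΣr Γ)) ⟩
    lookupS (η⁻¹ Γ ,, Dt (Σv (Γ ▸ B) (len Γ))) (len Γ)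
      ≡⟨ MP.lookupS-top (η⁻¹ Γ) _ (lenS-η⁻¹ Γ) ⟩
    Dt (Σv (Γ ▸ B) (len Γ))
      ≡⟨ cong Dt (Σv-top Γ B) ⟩
    var (suc (nu Γ))
      ≡⟨ cong var (sym (trans (MP.len-DC (ΣrC Γ)) (len-ΣrC Γ))) ⟩
    var (len (DC (ΣrC Γ))) ∎
    where open ≡-Reasoning
  lookupS-η-[η⁻¹] (Γ ▸ B@(Hom _ _ _)) {j} (M.there p) = begin
    lookupS (η Γ ,, var (len Γ)) j [ η⁻¹ (Γ ▸ B) ]t
      ≡⟨ cong (_[ η⁻¹ (Γ ▸ B) ]t) (MP.lookupS-pop (η Γ) _ j<η) ⟩
    lookupS (η Γ) j [ η⁻¹ (Γ ▸ B) ]t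
      ≡⟨ MP.[]t-extend (MP.ScopedTm-lenS (lenS-η⁻¹ Γ) (MP.lookupS-Scoped (η-Scoped Γ) j<η)) ⟩
    lookupS (η Γ) j [ η⁻¹ Γ ]t
      ≡⟨ lookupS-η-[η⁻¹] Γ p ⟩
    var-nf _ j ∎
    where
    open ≡-Reasoning
    j<η = subst (j <_) (sym (lenS-η≡len-DΣr Γ)) (MP.∋⇒<len p)

  lenS-DΣrS : ∀ {Γ γ Θ} → Γ MT.⊢ₛ γ ∶ DC Θ → lenS (DS (ΣrS Γ (DC Θ) γ)) ≡ suc (nu (DC Θ))
  lenS-DΣrS {Γ} {γ} {Θ} γ⊢ = trans (lenS-DS (ΣrS Γ (DC Θ) γ)) (lenS-ΣrS Γ (DC Θ) γ (MP.⊢ₛ⇒lenS γ⊢))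

  ≣DΣr[η]T : ∀ {Γ A} → Γ MT.⊢T A → Γ MT.⊢ A ≣T (DT (ΣrT Γ A) [ η Γ ]T)
  ≣DΣr[η]t : ∀ {Γ t A} → Γ MT.⊢ t ∶ A → Γ MT.⊢ t ≣ (Dt (Σrt Γ t) [ η Γ ]t) ∶ A
  ≣DΣr[η]ₛ : ∀ {Γ γ Θ} → Γ MT.⊢ₛ γ ∶ DC Θ →
             Γ MT.⊢ₛ γ ≣ ((DS (bullet Θ) ∘ₛ DS (ΣrS Γ (DC Θ) γ)) ∘ₛ η Γ) ∶ DC Θ
  ≣DΣr[η]T (MT.𝟙⊢ Γ⊢) = MT.𝟙≣ Γ⊢
  ≣DΣr[η]T (MT.Hom⊢ A⊢ t⊢ u⊢) = MT.Hom≣ (≣DΣr[η]T A⊢) (≣DΣr[η]t t⊢) (≣DΣr[η]t u⊢)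
  ≣DΣr[η]t {Γ} (MT.var⊢ Γ⊢ p) =
    subst (λ x → Γ MT.⊢ var _ ≣ x ∶ _) (sym (DΣv-[η] p)) (var≣var-nf Γ⊢ p)
  ≣DΣr[η]t {Γ} (MT.tt⊢ Γ⊢) = subst (λ x → Γ MT.⊢ tt ≣ x ∶ 𝟙) (sym (lookupS-η-• Γ)) (MT.refl≣ (MT.tt⊢ Γ⊢))
  ≣DΣr[η]t {Γ} (MT.mop⊢ {Θ = Θ} {A} {γ} A-op γ⊢) =
    subst (λ x → Γ MT.⊢ M.mop Θ A γ ≣ M.mop Θ A (x ∘ₛ η Γ) ∶ (DT A [ γ ]T))
      (sym (D-∘ₛ (bullet Θ) (ΣrS Γ (DC Θ) γ))) (MT.mop≣ A-op (≣DΣr[η]ₛ γ⊢))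
  ≣DΣr[η]t {Γ} (MT.mcoh⊢ {Θ = Θ} {A} {γ} A-coh γ⊢) =
    subst (λ x → Γ MT.⊢ M.mcoh Θ A γ ≣ M.mcoh Θ A (x ∘ₛ η Γ) ∶ (DT A [ γ ]T))
      (sym (D-∘ₛ (bullet Θ) (ΣrS Γ (DC Θ) γ))) (MT.mcoh≣ A-coh (≣DΣr[η]ₛ γ⊢))
  ≣DΣr[η]t (MT.conv⊢ t⊢ A≣B) = MT.conv≣ (≣DΣr[η]t t⊢) A≣B
  ≣DΣr[η]ₛ {Θ = C.∅} (MT.⟨⟩⊢ Γ⊢) = MT.⟨⟩≣ Γ⊢
  ≣DΣr[η]ₛ {Γ} {Θ = Θ C.▸ C.⋆} (MT.,,⊢ {γ = γ} {t = t} γ⊢ A⊢ t⊢) =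
    MT.,,≣ (≣DΣr[η]ₛ γ⊢) A⊢ (subst (λ u → Γ MT.⊢ t ≣ u ∶ 𝟙) (sym top≡tt) (MT.η𝟙 t⊢))
    where
    open ≡-Reasoning
    Σγ = ΣrS Γ (DC Θ) γ
    top≡tt : Dt (Σv (DC Θ ▸ 𝟙) (C.len Θ)) [ DS Σγ ]t [ η Γ ]t ≡ tt
    top≡tt = begin
      Dt (Σv (DC Θ ▸ 𝟙) (C.len Θ)) [ DS Σγ ]t [ η Γ ]t ≡⟨ cong (λ x → Dt x [ DS Σγ ]t [ η Γ ]t) (Σv-top-DC Θ 𝟙) ⟩
      lookupS (DS Σγ) 0 [ η Γ ]t                       ≡⟨ cong (_[ η Γ ]t) (sym (D-lookupS Σγ 0)) ⟩
      Dt (C.lookupS Σγ 0) [ η Γ ]t                     ≡⟨ cong (λ x → Dt x [ η Γ ]t) (ΣrS-• Γ (DC Θ) γ (MP.⊢ₛ⇒lenS γ⊢)) ⟩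
      lookupS (η Γ) 0                                  ≡⟨ lookupS-η-• Γ ⟩
      tt                                               ∎
  ≣DΣr[η]ₛ {Γ} {Θ = Θ C.▸ A@(C.Hom _ _ _)} (MT.,,⊢ {γ = γ} {t = t} γ⊢ A⊢ t⊢) =
    MT.,,≣ (subst (λ x → Γ MT.⊢ₛ γ ≣ x ∶ DC Θ) drop-top (≣DΣr[η]ₛ γ⊢)) A⊢
      (subst (λ x → Γ MT.⊢ t ≣ x ∶ (DT A [ γ ]T)) (cong (_[ η Γ ]t) (sym top≡)) (≣DΣr[η]t t⊢))
    where
    DΣγ = DS (ΣrS Γ (DC Θ) γ)
    drop-top : (DS (bullet Θ) ∘ₛ DΣγ) ∘ₛ η Γ ≡ (DS (bullet Θ) ∘ₛ (DΣγ ,, Dt (Σrt Γ t))) ∘ₛ η Γ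
    drop-top = cong (_∘ₛ η Γ) (sym (MP.∘ₛ-extend (MP.ScopedSub-lenS (lenS-DΣrS γ⊢) (MP.ScopedSub-D (bullet-Scoped Θ)))))
    top≡ : Dt (Σv (DC Θ ▸ DT A) (C.len Θ)) [ DΣγ ,, Dt (Σrt Γ t) ]t ≡ Dt (Σrt Γ t)
    top≡ = trans (cong (λ x → Dt x [ DΣγ ,, Dt (Σrt Γ t) ]t) (Σv-top-DC Θ (DT A))) (MP.lookupS-top DΣγ _ (lenS-DΣrS γ⊢))

  η-⊢ₛ : ∀ {Γ} → Γ MT.⊢ → Γ MT.⊢ₛ η Γ ∶ DC (ΣrC Γ)
  η-⊢ₛ MT.∅⊢ = MT.,,⊢ (MT.⟨⟩⊢ MT.∅⊢) (MT.𝟙⊢ MT.∅⊢) (MT.tt⊢ MT.∅⊢)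
  η-⊢ₛ (MT.▸⊢ (MT.𝟙⊢ Γ⊢)) = MP.⊢ₛ-weaken (MT.▸⊢ (MT.𝟙⊢ Γ⊢)) (η-⊢ₛ Γ⊢)
  η-⊢ₛ (MT.▸⊢ A⊢@(MT.Hom⊢ _ _ _)) =
    MT.,,⊢ (MP.⊢ₛ-weaken Γ▸A⊢ (η-⊢ₛ (MP.⊢T⇒⊢ A⊢))) (D-⊢T (Σr-⊢T A⊢))
      (MT.conv⊢ (MT.var⊢ Γ▸A⊢ M.here) (MP.≣T-weaken Γ▸A⊢ (≣DΣr[η]T A⊢)))
    where Γ▸A⊢ = MT.▸⊢ A⊢

  DΣrT-[η]-∘ₛ : ∀ {Γ A γ} → Γ MT.⊢T A → DT (ΣrT Γ A) [ η Γ ]T [ γ ]T ≡ DT (ΣrT Γ A) [ η Γ ∘ₛ γ ]T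
  DΣrT-[η]-∘ₛ {Γ} A⊢ = MP.[]T-∘ₛ-len (D-⊢T (Σr-⊢T A⊢)) (lenS-η≡len-DΣr Γ)

  η-natural : ∀ {Δ f Γ} → Δ MT.⊢ₛ f ∶ Γ → Δ MT.⊢ₛ (η Γ ∘ₛ f) ≣ (DS (ΣrS Δ Γ f) ∘ₛ η Δ) ∶ DC (ΣrC Γ)
  η-natural {Δ} (MT.⟨⟩⊢ Δ⊢) =
    MT.,,≣ (MT.⟨⟩≣ Δ⊢) (MT.𝟙⊢ MT.∅⊢) (subst (λ x → Δ MT.⊢ tt ≣ x ∶ 𝟙) (sym (lookupS-η-• Δ)) (MT.refl≣ (MT.tt⊢ Δ⊢)))
  η-natural {Δ} (MT.,,⊢ {Γ = Γ} {f} {𝟙} {t} f⊢ _ _) =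
    subst (λ x → Δ MT.⊢ₛ x ≣ (DS (ΣrS Δ Γ f) ∘ₛ η Δ) ∶ DC (ΣrC Γ))
      (sym (MP.∘ₛ-extend (MP.ScopedSub-lenS (MP.⊢ₛ⇒lenS f⊢) (η-Scoped Γ)))) (η-natural f⊢)
  η-natural {Δ} (MT.,,⊢ {Γ = Γ} {f} {A@(Hom _ _ _)} {t} f⊢ A⊢ t⊢) =
    subst (λ x → Δ MT.⊢ₛ x ≣ (DS (ΣrS Δ (Γ ▸ A) (f ,, t)) ∘ₛ η Δ) ∶ DC (ΣrC (Γ ▸ A)))
      (sym η[f,,t]) (MT.,,≣ (η-natural f⊢) (D-⊢T (Σr-⊢T A⊢)) t≣)
    where
    η[f,,t] : (η Γ ∘ₛ (f ,, t)) ,, lookupS (f ,, t) (len Γ) ≡ (η Γ ∘ₛ f) ,, t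
    η[f,,t] = cong₂ _,,_ (MP.∘ₛ-extend (MP.ScopedSub-lenS (MP.⊢ₛ⇒lenS f⊢) (η-Scoped Γ)))
                         (MP.lookupS-top f t (MP.⊢ₛ⇒lenS f⊢))
    t≣ : Δ MT.⊢ t ≣ (Dt (Σrt Δ t) [ η Δ ]t) ∶ (DT (ΣrT Γ A) [ η Γ ∘ₛ f ]T)
    t≣ = MT.conv≣ (≣DΣr[η]t t⊢)
           (subst (λ T → Δ MT.⊢ (A [ f ]T) ≣T T) (DΣrT-[η]-∘ₛ A⊢) (MP.≣T-[] f⊢ (≣DΣr[η]T A⊢)))

  η⁻¹-⊢ₛ : ∀ Γ → Γ MT.⊢ → DC (ΣrC Γ) MT.⊢ₛ η⁻¹ Γ ∶ Γ
  η∘η⁻¹≣idS : ∀ Γ → Γ MT.⊢ → DC (ΣrC Γ) MT.⊢ₛ (η Γ ∘ₛ η⁻¹ Γ) ≣ M.idS (DC (ΣrC Γ)) ∶ DC (ΣrC Γ)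
  η⁻¹-⊢ₛ M.∅ MT.∅⊢ = MT.⟨⟩⊢ (MT.▸⊢ (MT.𝟙⊢ MT.∅⊢))
  η⁻¹-⊢ₛ (Γ ▸ 𝟙) (MT.▸⊢ (MT.𝟙⊢ Γ⊢)) =
    MT.,,⊢ (η⁻¹-⊢ₛ Γ Γ⊢) (MT.𝟙⊢ Γ⊢)
      (subst (λ x → DC (ΣrC Γ) MT.⊢ x ∶ 𝟙) (cong Dt (sym (Σv-top Γ 𝟙))) (MT.var⊢ (D-⊢ (Σr-⊢ Γ⊢)) (D-∋ (ΣrC-∋• Γ))))
  η⁻¹-⊢ₛ (Γ ▸ A@(Hom _ _ _)) (MT.▸⊢ A⊢) =
    MT.,,⊢ (MP.⊢ₛ-weaken DΣrΓ▸⊢ η⁻¹⊢) A⊢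
      (subst (λ x → DC (ΣrC (Γ ▸ A)) MT.⊢ x ∶ (A [ η⁻¹ Γ ]T)) top≡
        (MT.conv⊢ (MT.var⊢ DΣrΓ▸⊢ M.here) (MP.≣T-weaken DΣrΓ▸⊢ DΣrA≣A)))
    where
    Γ⊢ = MP.⊢T⇒⊢ A⊢
    DΣrΓ▸⊢ = D-⊢ (Σr-⊢ (MT.▸⊢ A⊢))
    η⁻¹⊢ = η⁻¹-⊢ₛ Γ Γ⊢
    top≡ : var (len (DC (ΣrC Γ))) ≡ Dt (Σv (Γ ▸ A) (len Γ))
    top≡ = trans (cong var (trans (MP.len-DC (ΣrC Γ)) (len-ΣrC Γ))) (cong Dt (sym (Σv-top Γ A)))
    DΣrA[η][η⁻¹]≣DΣrA : DC (ΣrC Γ) MT.⊢ (DT (ΣrT Γ A) [ η Γ ]T [ η⁻¹ Γ ]T) ≣T DT (ΣrT Γ A)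
    DΣrA[η][η⁻¹]≣DΣrA = subst₂ (DC (ΣrC Γ) MT.⊢_≣T_) (sym (DΣrT-[η]-∘ₛ A⊢)) (MP.[]T-idS _ _)
      (MP.[]T-resp-≣ₛ (MP.⊢ₛ-∘ₛ (η-⊢ₛ Γ⊢) η⁻¹⊢) (η∘η⁻¹≣idS Γ Γ⊢) (D-⊢T (Σr-⊢T A⊢)))
    DΣrA≣A : DC (ΣrC Γ) MT.⊢ DT (ΣrT Γ A) ≣T (A [ η⁻¹ Γ ]T)
    DΣrA≣A = MT.symT (MT.transT (MP.≣T-[] η⁻¹⊢ (≣DΣr[η]T A⊢)) DΣrA[η][η⁻¹]≣DΣrA)
  η∘η⁻¹≣idS Γ Γ⊢ = ∘ₛ≣idS-pointwise (D-⊢ (Σr-⊢ Γ⊢)) (η-⊢ₛ Γ⊢) (η⁻¹-⊢ₛ Γ Γ⊢) (lookupS-η-[η⁻¹] Γ)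

  η⁻¹∘η≣idS : ∀ Γ → Γ MT.⊢ → Γ MT.⊢ₛ (η⁻¹ Γ ∘ₛ η Γ) ≣ M.idS Γ ∶ Γ
  η⁻¹∘η≣idS Γ Γ⊢ = ∘ₛ≣idS-pointwise Γ⊢ (η⁻¹-⊢ₛ Γ Γ⊢) (η-⊢ₛ Γ⊢)
    (λ {i} p → trans (cong (_[ η Γ ]t) (lookupS-η⁻¹ Γ i (MP.∋⇒<len p))) (DΣv-[η] p))

  Dbullet∘η≣idS : ∀ {Θ} → Θ C.⊢ → DC Θ MT.⊢ₛ (DS (bullet Θ) ∘ₛ η (DC Θ)) ≣ M.idS (DC Θ) ∶ DC Θ
  Dbullet∘η≣idS {Θ} Θ⊢ = ∘ₛ≣idS-pointwise (D-⊢ Θ⊢) (D-⊢ₛ (bullet-⊢ₛ Θ⊢)) (η-⊢ₛ (D-⊢ Θ⊢)) λ {i} p →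
    let i<Θ = subst (i <_) (MP.len-DC Θ) (MP.∋⇒<len p) in
    trans (cong (_[ η (DC Θ) ]t) (trans (sym (D-lookupS (bullet Θ) i)) (cong Dt (sym (Σv-DC≡lookupS-bullet Θ i i<Θ)))))
          (DΣv-[η] p)

  ΣrS-η : ∀ Γ → ΣrS Γ (DC (ΣrC Γ)) (η Γ) ≡ C.idS (ΣrC Γ)
  ΣrS-η M.∅ = refl
  ΣrS-η (Γ ▸ 𝟙) = trans (ΣrS-weaken {Γ} {𝟙} {DC (ΣrC Γ)} (η-Scoped Γ)) (ΣrS-η Γ)
  ΣrS-η (Γ ▸ B@(Hom _ _ _)) = cong₂ C._,,_
    (trans (ΣrS-weaken {Γ} {B} {DC (ΣrC Γ)} (η-Scoped Γ)) (ΣrS-η Γ))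
    (trans (Σv-top Γ B) (cong C.var (sym (len-ΣrC Γ))))

  nu-DΣr : ∀ Γ → nu (DC (ΣrC Γ)) ≡ nu Γ
  nu-DΣr M.∅ = refl
  nu-DΣr (Γ ▸ 𝟙) = nu-DΣr Γ
  nu-DΣr (Γ ▸ Hom _ _ _) = cong suc (nu-DΣr Γ)

  bullet-ΣrC : ∀ Γ → bullet (ΣrC Γ) ≡ C.idS (ΣrC Γ)
  bullet-ΣrC M.∅ = refl
  bullet-ΣrC (Γ ▸ 𝟙) = bullet-ΣrC Γ
  bullet-ΣrC (Γ ▸ B@(Hom _ _ _)) = cong₂ C._,,_ (bullet-ΣrC Γ)
    (trans (Σv-top-DC (ΣrC Γ) (DT (ΣrT Γ B))) (cong C.var (trans (cong suc (nu-DΣr Γ)) (sym (len-ΣrC Γ)))))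

  bullet∘Σrη≡idS : ∀ Γ → bullet (ΣrC Γ) C.∘ₛ ΣrS Γ (DC (ΣrC Γ)) (η Γ) ≡ C.idS (ΣrC Γ)
  bullet∘Σrη≡idS Γ = trans (cong₂ C._∘ₛ_ (bullet-ΣrC Γ) (ΣrS-η Γ)) (CP.∘ₛ-identityʳ (ΣrC Γ) (C.idS (ΣrC Γ)))

open AdjunctionUnit

Σr⊣D : Adjunction (SynFunctor MCaTT-isSynCat CaTT-isSynCat Σr-isSynFunctor)
                  (SynFunctor CaTT-isSynCat MCaTT-isSynCat D-isSynFunctor)
Σr⊣D = record
  { unit = λ (Γ , Γ⊢) → η Γ , η-⊢ₛ Γ⊢
  ; counit = λ (Θ , Θ⊢) → bullet Θ , bullet-⊢ₛ Θ⊢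
  ; unit-natural = λ {_} {Γ'} (_ , f⊢) → MP.≣ₛ-sym (MP.⊢ₛ-∘ₛ (η-⊢ₛ (proj₂ Γ')) f⊢) (η-natural f⊢)
  ; counit-natural = λ (_ , γ⊢) → bullet-natural γ⊢
  ; zig = λ (Γ , _) → bullet∘Σrη≡idS Γ
  ; zag = λ (_ , Θ⊢) → Dbullet∘η≣idS Θ⊢
  }

mainTheorem1 :
    Σ[ synC ∈ IsSynCat CaTT ] Σ[ synM ∈ IsSynCat MCaTT ]
    Σ[ fΣr ∈ IsSynFunctor MCaTT CaTT ΣrC ΣrS ]
    Σ[ fD ∈ IsSynFunctor CaTT MCaTT DC D₁ ]
    Σ[ adj ∈ Adjunction (SynFunctor synM synC fΣr) (SynFunctor synC synM fD) ]
      ((∀ (Γ : Category.Obj (Syn CaTT synC)) → proj₁ (Adjunction.counit {Syn MCaTT synM} {Syn CaTT synC} adj Γ) ≡ bullet (proj₁ Γ))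
       × (∀ (Δ : Category.Obj (Syn MCaTT synM)) → IsIso (Syn MCaTT synM) {Δ}
           {Functor.F₀ (SynFunctor synC synM fD) (Functor.F₀ (SynFunctor synM synC fΣr) Δ)}
           (Adjunction.unit {Syn MCaTT synM} {Syn CaTT synC} adj Δ)))
mainTheorem1 =
  CaTT-isSynCat , MCaTT-isSynCat , Σr-isSynFunctor , D-isSynFunctor , Σr⊣D ,
  (λ _ → refl) ,
  λ (Γ , Γ⊢) → (η⁻¹ Γ , η⁻¹-⊢ₛ Γ Γ⊢) , η⁻¹∘η≣idS Γ Γ⊢ , η∘η⁻¹≣idS Γ Γ⊢
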